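{- Let $s$ and $l$ be integers with $s\geq l\geq 0$, and let $j$ be an integer. Then \begin{align*} &\sum_{m=0}^{\lfloor (l-1)/2\rfloor}\sum_{i=2m}^{l-1} (-2)^{i-2m}\left\{\binom{s-l}{i-2m,\,j-l+m,\,s-i-j+m} \, \beta_{m}(s,l,i+j-l,l-i)\right.\\ &\qquad\qquad+\left.\binom{s-l}{i-2m,\,j-i+m,\,s-l-j+m} \, \beta_{m}(s,l,l+j-i,i-l)\right\}\\ &\qquad\qquad+\sum_{m=0}^{\lfloor l/2\rfloor}(-2)^{l-2m}\binom{s-l}{l-2m,\,j-l+m,\,s-l-j+m} \, \beta_{m}(s,l,j,0)=\binom{s}{j}, \end{align*} where $\lfloor x\rfloor$ denotes the largest integer $\leq x$. (In particular the left-hand side does not depend on $l$.)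
   Context: Multinomial coefficients: for a positive integer $k$ and integers $r_1,\dots,r_k$ with $n=r_1+\cdots+r_k\geq 0$, $\binom{n}{r_1,\dots,r_k}=\frac{n!}{r_1!\cdots r_k!}$ if all $r_i\geq 0$, and $\binom{n}{r_1,\dots,r_k}=0$ otherwise. Binomial coefficients: for $n\geq 0$ and any integer $r$, $\binom{n}{r}=\binom{n}{r,\,n-r}$ (so it is $0$ if $r<0$ or $r>n$). For an integer $b$ put $b_{+}=\frac{|b|+b}{2}$ and $b_{ - }=\frac{|b|-b}{2}$. For integers $a,b,s,l,m$ with $s\geq a\geq 0$ and $s\geq l$, define $$\beta_{m}(s,l,a,b)=\sum_{n=0}^{|b|+m}\binom{s-a}{b_{+}+m-n}\binom{a}{b_{ - }+m-n}\binom{s-l+n}{n}$$ (an empty sum is $0$). A product of a vanishing multinomial coefficient with a $\beta$-term is taken to be $0$; whenever the multinomial coefficient in a term is nonzero, the accompanying $\beta$ has arguments satisfying $s\geq a\geq 0$. -}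

module Defs where

open import Data.Nat as ℕ using (ℕ; zero; suc; _!)
open import Data.Nat.Properties using (_!≢0; m*n≢0)

open import Data.Integer as ℤ using (ℤ; +_; _+_; _-_; _*_; -_; ∣_∣; _⊔_; _≤?_; _/ℕ_)
open import Data.List using (List; []; _∷_; map; foldr)
open import Data.Bool using (Bool; true; false; if_then_else_; _∧_)
open import Relation.Nullary.Decidable using (⌊_⌋)

prodFact : List ℕ → ℕ
prodFact []       = 1
prodFact (r ∷ rs) = (r !) ℕ.* prodFact rs

prodFact≢0 : ∀ rs → ℕ.NonZero (prodFact rs)
prodFact≢0 []       = _
prodFact≢0 (r ∷ rs) = m*n≢0 (r !) (prodFact rs) {{r !≢0}} {{prodFact≢0 rs}}

sumℤ : List ℤ → ℤ
sumℤ = foldr _+_ (+ 0)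

allNonneg : List ℤ → Bool
allNonneg = foldr (λ r b → ⌊ + 0 ≤? r ⌋ ∧ b) true

-- Multinomial coefficient  binom(n; r₁,…,r_k)  with n = r₁+⋯+r_k :
-- n! / (r₁! ⋯ r_k!) if all rᵢ ≥ 0, and 0 otherwise.
multinomial : List ℤ → ℤ
multinomial rs =
  if allNonneg rs
  then + ((∣ sumℤ rs ∣ !) ℕ./ prodFact (map ∣_∣ rs)) {{prodFact≢0 (map ∣_∣ rs)}}
  else + 0

binomial : ℤ → ℤ → ℤ
binomial n r = multinomial (r ∷ (n - r) ∷ [])

_₊ : ℤ → ℤ
b ₊ = ((+ ∣ b ∣) + b) /ℕ 2

_₋ : ℤ → ℤ
b ₋ = ((+ ∣ b ∣) - b) /ℕ 2

⌊_/2⌋ : ℤ → ℤ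
⌊ x /2⌋ = x /ℕ 2

sumFrom : ℤ → ℕ → (ℤ → ℤ) → ℤ
sumFrom lo zero    f = + 0
sumFrom lo (suc c) f = f lo + sumFrom (lo + + 1) c f

-- Σ_{k=lo}^{hi} f k  over integers; empty (= 0) when hi < lo
Σ[_to_] : ℤ → ℤ → (ℤ → ℤ) → ℤ
Σ[ lo to hi ] f = sumFrom lo ∣ ((hi - lo) + + 1) ⊔ + 0 ∣ f

β : ℤ → ℤ → ℤ → ℤ → ℤ → ℤ
β m s l a b =
  Σ[ + 0 to (+ ∣ b ∣) + m ] (λ n →
    binomial (s - a) ((b ₊) + m - n)
    * binomial a ((b ₋) + m - n)
    * binomial (s - l + n) n)

pow-2 : ℤ → ℤ
pow-2 e = (- + 2) ℤ.^ ∣ e ∣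

module Submission where

open import Defs
open import Data.Nat as ℕ using (ℕ; zero; suc; _!)
open import Data.Nat.Properties as ℕP using (_!*_!≢0)
open import Data.Nat.Combinatorics
  using (_C_; nCk≡n!/k![n-k]!; k![n∸k]!∣n!; k>n⇒nCk≡0; nCn≡1; nCk+nC[k+1]≡[n+1]C[k+1]; nCk≡nC[n∸k])
open import Data.Nat.DivMod using (m/n*n≡m; m*n/n≡m; /-congˡ; m≡m%n+[m/n]*n; m%n<n)
open import Data.Nat.Tactic.RingSolver as ℕSolver using ()
open import Data.Integer as ℤ using (ℤ; +_; -[1+_]; _+_; _-_; _*_; -_; _≤_; _⊔_; ∣_∣; _/ℕ_)
open import Data.Integer.Properties as ℤP using ()
open import Data.Integer.Tactic.RingSolver using (solve-∀)
open import Data.Product using (Σ; _,_; _×_)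
open import Data.Sum using (_⊎_; inj₁; inj₂)
open import Data.List using ([]; _∷_)
open import Relation.Binary.PropositionalEquality

-- Theorem 1.1 by a Pascal recursion in t = s - l.
--
-- Put d = j - l and let C(n, k) be the binomial coefficient extended to every integer
-- upper index, so that Pascal's rule holds without exception.  With the kernel
--   K_t(U, V; A, G) = Σ_n C(t+n, n) C(U, G-n) C(V, A-n),
--   κ_t(α, γ)       = K_t(t - d + γ - α, l + d - γ + α; α, γ),
-- consider the double sum over the square 0 ≤ α, γ ≤ l + 1
--   S(t, l, d) = Σ_{α,γ} (-2)^{l-α-γ} C(t; l-α-γ, α+d) κ_t(α, γ).  Summing S by hooks gives the left-hand side, so it equals C(s, j).

cong₃ : ∀ {A B C D : Set} (f : A → B → C → D) {a a' b b' c c'} → a ≡ a' → b ≡ b' → c ≡ c' → f a b c ≡ f a' b' c'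
cong₃ f refl refl refl = refl

∑ : ℤ → ℕ → (ℤ → ℤ) → ℤ
∑ = sumFrom

+1+ : ∀ lo i → lo + + 1 + + i ≡ lo + + suc i
+1+ lo i = ℤP.+-assoc lo (+ 1) (+ i)

∑-cong : ∀ lo c {f g : ℤ → ℤ} → (∀ i → i ℕ.< c → f (lo + + i) ≡ g (lo + + i)) →
         ∑ lo c f ≡ ∑ lo c g
∑-cong lo zero h = refl
∑-cong lo (suc c) {f} {g} h = cong₂ _+_ head (∑-cong (lo + + 1) c tail)
  where
  head : f lo ≡ g lo
  head = subst (λ x → f x ≡ g x) (ℤP.+-identityʳ lo) (h 0 (ℕ.s≤s ℕ.z≤n))
  tail : ∀ i → i ℕ.< c → f (lo + + 1 + + i) ≡ g (lo + + 1 + + i)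
  tail i i<c = subst (λ x → f x ≡ g x) (sym (+1+ lo i)) (h (suc i) (ℕ.s≤s i<c))

∑-ext : ∀ lo c {f g : ℤ → ℤ} → (∀ k → f k ≡ g k) → ∑ lo c f ≡ ∑ lo c g
∑-ext lo zero h = refl
∑-ext lo (suc c) h = cong₂ _+_ (h lo) (∑-ext (lo + + 1) c h)

∑-+ : ∀ lo c (f g : ℤ → ℤ) → ∑ lo c (λ k → f k + g k) ≡ ∑ lo c f + ∑ lo c g
∑-+ lo zero f g = refl
∑-+ lo (suc c) f g =
  trans (cong (_+_ (f lo + g lo)) (∑-+ (lo + + 1) c f g)) (interchange (f lo) (g lo) _ _)
  where
  interchange : ∀ a b x y → a + b + (x + y) ≡ a + x + (b + y)
  interchange = solve-∀

∑-neg : ∀ lo c (f : ℤ → ℤ) → ∑ lo c (λ k → - f k) ≡ - ∑ lo c f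
∑-neg lo zero f = refl
∑-neg lo (suc c) f =
  trans (cong (_+_ (- f lo)) (∑-neg (lo + + 1) c f)) (sym (ℤP.neg-distrib-+ (f lo) _))

∑-- : ∀ lo c (f g : ℤ → ℤ) → ∑ lo c (λ k → f k - g k) ≡ ∑ lo c f - ∑ lo c g
∑-- lo c f g = trans (∑-+ lo c f (λ k → - g k)) (cong (_+_ (∑ lo c f)) (∑-neg lo c g))

∑-vanish : ∀ lo c (f : ℤ → ℤ) → (∀ i → i ℕ.< c → f (lo + + i) ≡ + 0) → ∑ lo c f ≡ + 0
∑-vanish lo zero f h = refl
∑-vanish lo (suc c) f h = begin
  f lo + ∑ (lo + + 1) c f  ≡⟨ cong₂ _+_ (subst (λ x → f x ≡ + 0) (ℤP.+-identityʳ lo) (h 0 (ℕ.s≤s ℕ.z≤n)))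
                                        (∑-vanish (lo + + 1) c f tail) ⟩
  + 0                      ∎
  where
  open ≡-Reasoning
  tail : ∀ i → i ℕ.< c → f (lo + + 1 + + i) ≡ + 0
  tail i i<c = subst (λ x → f x ≡ + 0) (sym (+1+ lo i)) (h (suc i) (ℕ.s≤s i<c))

∑-snoc : ∀ lo c (f : ℤ → ℤ) → ∑ lo (suc c) f ≡ ∑ lo c f + f (lo + + c)
∑-snoc lo zero f =
  trans (ℤP.+-identityʳ (f lo)) (trans (cong f (sym (ℤP.+-identityʳ lo))) (sym (ℤP.+-identityˡ _)))
∑-snoc lo (suc c) f = begin
  f lo + ∑ (lo + + 1) (suc c) f             ≡⟨ cong (_+_ (f lo)) (∑-snoc (lo + + 1) c f) ⟩
  f lo + (∑ (lo + + 1) c f + f (lo + + 1 + + c)) ≡⟨ sym (ℤP.+-assoc (f lo) _ _) ⟩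
  f lo + ∑ (lo + + 1) c f + f (lo + + 1 + + c)   ≡⟨ cong (λ k → f lo + ∑ (lo + + 1) c f + f k) (+1+ lo c) ⟩
  f lo + ∑ (lo + + 1) c f + f (lo + + suc c)     ∎
  where open ≡-Reasoning

∑-split : ∀ lo a b (f : ℤ → ℤ) → ∑ lo (a ℕ.+ b) f ≡ ∑ lo a f + ∑ (lo + + a) b f
∑-split lo zero b f =
  trans (cong (λ x → ∑ x b f) (sym (ℤP.+-identityʳ lo))) (sym (ℤP.+-identityˡ _))
∑-split lo (suc a) b f = begin
  f lo + ∑ (lo + + 1) (a ℕ.+ b) f                                ≡⟨ cong (_+_ (f lo)) (∑-split (lo + + 1) a b f) ⟩
  f lo + (∑ (lo + + 1) a f + ∑ (lo + + 1 + + a) b f)             ≡⟨ sym (ℤP.+-assoc (f lo) _ _) ⟩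
  f lo + ∑ (lo + + 1) a f + ∑ (lo + + 1 + + a) b f               ≡⟨ cong (λ x → f lo + ∑ (lo + + 1) a f + ∑ x b f) (+1+ lo a) ⟩
  f lo + ∑ (lo + + 1) a f + ∑ (lo + + suc a) b f                 ∎
  where open ≡-Reasoning

∑-shift : ∀ lo c δ (f : ℤ → ℤ) → ∑ lo c (λ k → f (k + δ)) ≡ ∑ (lo + δ) c f
∑-shift lo zero δ f = refl
∑-shift lo (suc c) δ f =
  cong (_+_ (f (lo + δ))) (trans (∑-shift (lo + + 1) c δ f) (cong (λ x → ∑ x c f) (swap lo δ)))
  where
  swap : ∀ a b → a + + 1 + b ≡ a + b + + 1
  swap = solve-∀

∑-up : ∀ lo c (f : ℤ → ℤ) → f lo ≡ + 0 → f (lo + + c) ≡ + 0 →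
       ∑ lo c (λ k → f (k + + 1)) ≡ ∑ lo c f
∑-up lo c f first last = begin
  ∑ lo c (λ k → f (k + + 1))  ≡⟨ ∑-shift lo c (+ 1) f ⟩
  ∑ (lo + + 1) c f            ≡⟨ sym (ℤP.+-identityˡ _) ⟩
  + 0 + ∑ (lo + + 1) c f      ≡⟨ cong (_+ ∑ (lo + + 1) c f) (sym first) ⟩
  ∑ lo (suc c) f              ≡⟨ ∑-snoc lo c f ⟩
  ∑ lo c f + f (lo + + c)     ≡⟨ cong (_+_ (∑ lo c f)) last ⟩
  ∑ lo c f + + 0              ≡⟨ ℤP.+-identityʳ _ ⟩
  ∑ lo c f                    ∎
  where open ≡-Reasoning

∑-down : ∀ lo c (f : ℤ → ℤ) → f (lo - + 1) ≡ + 0 → f (lo + + c - + 1) ≡ + 0 →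
         ∑ lo c (λ k → f (k - + 1)) ≡ ∑ lo c f
∑-down lo c f first last =
  sym (trans (∑-ext lo c (λ k → cong f (back k))) (∑-up lo c (λ k → f (k - + 1)) first last))
  where
  back : ∀ k → k ≡ k + + 1 - + 1
  back = solve-∀

∑-reverse : ∀ lo c (f : ℤ → ℤ) → ∑ lo c f ≡ ∑ lo c (λ x → f (lo + lo + + c - + 1 - x))
∑-reverse lo zero f = refl
∑-reverse lo (suc c) f = sym (begin
  f (R - lo) + ∑ (lo + + 1) c g  ≡⟨ cong₂ _+_ (cong f (firstIsLast lo (+ c))) reversedTail ⟩
  f (lo + + c) + ∑ lo c f        ≡⟨ ℤP.+-comm (f (lo + + c)) (∑ lo c f) ⟩
  ∑ lo c f + f (lo + + c)        ≡⟨ sym (∑-snoc lo c f) ⟩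
  ∑ lo (suc c) f                 ∎)
  where
  open ≡-Reasoning
  R = lo + lo + + suc c - + 1
  g = λ x → f (R - x)
  firstIsLast : ∀ lo c → lo + lo + (+ 1 + c) - + 1 - lo ≡ lo + c
  firstIsLast = solve-∀
  reflect : ∀ lo c x → lo + + 1 + (lo + + 1) + c - + 1 - x - + 1 ≡ lo + lo + (+ 1 + c) - + 1 - x
  reflect = solve-∀
  cancel : ∀ lo → lo + + 1 + - + 1 ≡ lo
  cancel = solve-∀
  reversedTail : ∑ (lo + + 1) c g ≡ ∑ lo c f
  reversedTail = begin
    ∑ (lo + + 1) c g                                                       ≡⟨ ∑-ext (lo + + 1) c (λ x → cong f (sym (reflect lo (+ c) x))) ⟩
    ∑ (lo + + 1) c (λ x → f (lo + + 1 + (lo + + 1) + + c - + 1 - x - + 1)) ≡⟨ sym (∑-reverse (lo + + 1) c (λ y → f (y - + 1))) ⟩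
    ∑ (lo + + 1) c (λ y → f (y + - + 1))                                   ≡⟨ ∑-shift (lo + + 1) c (- + 1) f ⟩
    ∑ (lo + + 1 + - + 1) c f                                               ≡⟨ cong (λ z → ∑ z c f) (cancel lo) ⟩
    ∑ lo c f                                                               ∎

∑-extend : ∀ c c' (f : ℤ → ℤ) → c ℕ.≤ c' → (∀ i → c ℕ.≤ i → f (+ i) ≡ + 0) →
           ∑ (+ 0) c f ≡ ∑ (+ 0) c' f
∑-extend c c' f c≤c' beyond = begin
  ∑ (+ 0) c f                               ≡⟨ sym (ℤP.+-identityʳ _) ⟩
  ∑ (+ 0) c f + + 0                         ≡⟨ cong (_+_ (∑ (+ 0) c f)) (sym (∑-vanish (+ 0 + + c) (c' ℕ.∸ c) f extra)) ⟩
  ∑ (+ 0) c f + ∑ (+ 0 + + c) (c' ℕ.∸ c) f  ≡⟨ sym (∑-split (+ 0) c (c' ℕ.∸ c) f) ⟩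
  ∑ (+ 0) (c ℕ.+ (c' ℕ.∸ c)) f              ≡⟨ cong (λ z → ∑ (+ 0) z f) (ℕP.m+[n∸m]≡n c≤c') ⟩
  ∑ (+ 0) c' f                              ∎
  where
  open ≡-Reasoning
  extra : ∀ i → i ℕ.< c' ℕ.∸ c → f (+ 0 + + c + + i) ≡ + 0
  extra i _ = subst (λ x → f x ≡ + 0) (cong (_+ + i) (sym (ℤP.+-identityˡ (+ c))))
                    (beyond (c ℕ.+ i) (ℕP.m≤m+n c i))

∑-extend₂ : ∀ c c' (f : ℤ → ℤ) → (∀ i → c ℕ.≤ i → f (+ i) ≡ + 0) →
            (∀ i → c' ℕ.≤ i → f (+ i) ≡ + 0) → ∑ (+ 0) c f ≡ ∑ (+ 0) c' f
∑-extend₂ c c' f beyond beyond' with ℕP.≤-total c c'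
... | inj₁ c≤c' = ∑-extend c c' f c≤c' beyond
... | inj₂ c'≤c = sym (∑-extend c' c f c'≤c beyond')

∑∑ : ℕ → (ℤ → ℤ → ℤ) → ℤ
∑∑ b f = ∑ (+ 0) b (λ α → ∑ (+ 0) b (λ γ → f α γ))

∑∑-ext : ∀ b (f g : ℤ → ℤ → ℤ) → (∀ α γ → f α γ ≡ g α γ) → ∑∑ b f ≡ ∑∑ b g
∑∑-ext b f g h = ∑-ext (+ 0) b (λ α → ∑-ext (+ 0) b (h α))

∑∑-+ : ∀ b f g → ∑∑ b (λ α γ → f α γ + g α γ) ≡ ∑∑ b f + ∑∑ b g
∑∑-+ b f g = trans (∑-ext (+ 0) b (λ α → ∑-+ (+ 0) b (f α) (g α))) (∑-+ (+ 0) b _ _)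

∑∑-- : ∀ b f g → ∑∑ b (λ α γ → f α γ - g α γ) ≡ ∑∑ b f - ∑∑ b g
∑∑-- b f g = trans (∑-ext (+ 0) b (λ α → ∑-- (+ 0) b (f α) (g α))) (∑-- (+ 0) b _ _)

-- The square [0, b)² decomposed into hooks: the hook at m consists of the diagonal point
-- (m, m) and the pairs (m, m+1+k), (m+1+k, m); the arm length L ≥ b is arbitrary.
hookSum : ℕ → ℕ → (ℤ → ℤ → ℤ) → ℤ
hookSum b L G = ∑ (+ 0) b (λ m → G m m + ∑ (+ 0) L (λ k → G m (m + + 1 + k) + G (m + + 1 + k) m))

-- Summing over the square by hooks, for a summand vanishing outside the square.
-- Induction on b peels off the hook at 0 and shifts the remaining square by (1, 1).
∑∑≡hookSum : ∀ b L (G : ℤ → ℤ → ℤ) → b ℕ.≤ L →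
             (∀ i k → b ℕ.≤ i ⊎ b ℕ.≤ k → G (+ i) (+ k) ≡ + 0) → ∑∑ b G ≡ hookSum b L G
∑∑≡hookSum zero L G _ _ = refl
∑∑≡hookSum (suc b) L G b<L outside = begin
  ∑∑ (suc b) G
    ≡⟨⟩
  (G (+ 0) (+ 0) + ∑ (+ 1) b (G (+ 0))) + ∑ (+ 1) b (λ α → ∑ (+ 0) (suc b) (G α))
    ≡⟨ cong₂ (λ x y → (G (+ 0) (+ 0) + x) + y) (sym (∑-shift (+ 0) b (+ 1) (G (+ 0))))
             (sym (∑-shift (+ 0) b (+ 1) (λ α → ∑ (+ 0) (suc b) (G α)))) ⟩
  (G₀₀ + row) + ∑ (+ 0) b (λ α → G (α + + 1) (+ 0) + ∑ (+ 1) b (G (α + + 1)))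
    ≡⟨ cong (_+_ (G₀₀ + row)) (trans (∑-ext (+ 0) b (λ α → cong (_+_ (G (α + + 1) (+ 0)))
                                       (sym (∑-shift (+ 0) b (+ 1) (G (α + + 1))))))
                                     (∑-+ (+ 0) b _ _)) ⟩
  (G₀₀ + row) + (column + ∑∑ b G')
    ≡⟨ cong (λ z → (G₀₀ + row) + (column + z)) (∑∑≡hookSum b L G' (ℕP.≤-trans (ℕP.n≤1+n b) b<L) outside') ⟩
  (G₀₀ + row) + (column + hookSum b L G')
    ≡⟨ regroup G₀₀ row column (hookSum b L G') ⟩
  (G₀₀ + (row + column)) + hookSum b L G'
    ≡⟨ cong₂ (λ x y → (G₀₀ + x) + y) firstHook shiftedHooks ⟩
  (G₀₀ + ∑ (+ 0) L arm₀) + ∑ (+ 0) b (λ m → hook (m + + 1))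
    ≡⟨ cong (_+_ (G₀₀ + ∑ (+ 0) L arm₀)) (∑-shift (+ 0) b (+ 1) hook) ⟩
  hookSum (suc b) L G ∎
  where
  open ≡-Reasoning
  G₀₀ = G (+ 0) (+ 0)
  row = ∑ (+ 0) b (λ k → G (+ 0) (k + + 1))
  column = ∑ (+ 0) b (λ α → G (α + + 1) (+ 0))
  G' : ℤ → ℤ → ℤ
  G' a c = G (a + + 1) (c + + 1)
  hook : ℤ → ℤ
  hook m = G m m + ∑ (+ 0) L (λ k → G m (m + + 1 + k) + G (m + + 1 + k) m)
  arm₀ : ℤ → ℤ
  arm₀ k = G (+ 0) (+ 0 + + 1 + k) + G (+ 0 + + 1 + k) (+ 0)
  regroup : ∀ a b c d → (a + b) + (c + d) ≡ (a + (b + c)) + d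
  regroup = solve-∀
  outside' : ∀ i k → b ℕ.≤ i ⊎ b ℕ.≤ k → G' (+ i) (+ k) ≡ + 0
  outside' i k (inj₁ p) = outside (i ℕ.+ 1) (k ℕ.+ 1) (inj₁ (subst (suc b ℕ.≤_) (ℕP.+-comm 1 i) (ℕ.s≤s p)))
  outside' i k (inj₂ p) = outside (i ℕ.+ 1) (k ℕ.+ 1) (inj₂ (subst (suc b ℕ.≤_) (ℕP.+-comm 1 k) (ℕ.s≤s p)))
  succ : ∀ k → k + + 1 ≡ + 0 + + 1 + k
  succ = solve-∀
  firstHook : row + column ≡ ∑ (+ 0) L arm₀
  firstHook = begin
    row + column                                            ≡⟨ sym (∑-+ (+ 0) b _ _) ⟩
    ∑ (+ 0) b (λ k → G (+ 0) (k + + 1) + G (k + + 1) (+ 0)) ≡⟨ ∑-ext (+ 0) b (λ k → cong₂ (λ x y → G (+ 0) x + G y (+ 0)) (succ k) (succ k)) ⟩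
    ∑ (+ 0) b arm₀                                          ≡⟨ ∑-extend b L arm₀ (ℕP.≤-trans (ℕP.n≤1+n b) b<L) armOutside ⟩
    ∑ (+ 0) L arm₀                                          ∎
    where
    armOutside : ∀ i → b ℕ.≤ i → arm₀ (+ i) ≡ + 0
    armOutside i b≤i = cong₂ _+_ (outside 0 (suc (0 ℕ.+ i)) (inj₂ (ℕ.s≤s b≤i)))
                                 (outside (suc (0 ℕ.+ i)) 0 (inj₁ (ℕ.s≤s b≤i)))
  reindex : ∀ m k → m + + 1 + k + + 1 ≡ m + + 1 + + 1 + k
  reindex = solve-∀
  shiftedHooks : hookSum b L G' ≡ ∑ (+ 0) b (λ m → hook (m + + 1))
  shiftedHooks = ∑-ext (+ 0) b (λ m → cong (_+_ (G (m + + 1) (m + + 1)))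
                   (∑-ext (+ 0) L (λ k → cong₂ (λ x y → G (m + + 1) x + G y (m + + 1)) (reindex m k) (reindex m k))))

product-vanishesᵐ : ∀ a b c → b ≡ + 0 → a * b * c ≡ + 0
product-vanishesᵐ a b c refl = cong (_* c) (ℤP.*-zeroʳ a)

product-vanishesʳ : ∀ a b c → c ≡ + 0 → a * b * c ≡ + 0
product-vanishesʳ a b c refl = ℤP.*-zeroʳ (a * b)

sign : ℕ → ℤ
sign k = (- + 1) ℤ.^ k

-- Unlike the coefficient of
-- the statement it satisfies Pascal's rule everywhere, which is what the recurrences need.
choose : ℤ → ℤ → ℤ
choose n       -[1+ _ ] = + 0
choose (+ n)   (+ k)    = + (n C k)
choose -[1+ m ] (+ k)   = sign k * + ((m ℕ.+ k) C k)

choose-zero : ∀ n → choose n (+ 0) ≡ + 1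
choose-zero (+ n)    = refl
choose-zero -[1+ m ] = refl

choose-above : ∀ n k → n ℕ.< k → choose (+ n) (+ k) ≡ + 0
choose-above n k n<k = cong +_ (k>n⇒nCk≡0 n<k)

pascal : ∀ n k → choose (n + + 1) k ≡ choose n k + choose n (k - + 1)
pascal n -[1+ _ ] = refl
pascal n (+ zero) = trans (choose-zero (n + + 1)) (cong (_+ + 0) (sym (choose-zero n)))
pascal (+ n) (+ suc k) = begin
  + ((n ℕ.+ 1) C suc k)         ≡⟨ cong (λ x → + (x C suc k)) (ℕP.+-comm n 1) ⟩
  + (suc n C suc k)             ≡⟨ cong +_ (sym (nCk+nC[k+1]≡[n+1]C[k+1] n k)) ⟩
  + (n C k) + + (n C suc k)     ≡⟨ ℤP.+-comm (+ (n C k)) (+ (n C suc k)) ⟩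
  + (n C suc k) + + (n C k)     ∎
  where open ≡-Reasoning
pascal -[1+ zero ] (+ suc k) = begin
  + 0                                           ≡⟨ signsCancel (sign k) ⟩
  - + 1 * sign k * + 1 + sign k * + 1           ≡⟨ cong₂ (λ a b → - + 1 * sign k * + a + sign k * + b) (sym (nCn≡1 (suc k))) (sym (nCn≡1 k)) ⟩
  choose -[1+ 0 ] (+ suc k) + choose -[1+ 0 ] (+ k) ∎
  where
  open ≡-Reasoning
  signsCancel : ∀ x → + 0 ≡ - + 1 * x * + 1 + x * + 1
  signsCancel = solve-∀
pascal -[1+ suc m ] (+ suc k) = begin
  - + 1 * sign k * + B                                ≡⟨ regroup (sign k) (+ A) (+ B) ⟩
  - + 1 * sign k * (+ A + + B) + sign k * + A         ≡⟨ cong₂ (λ a b → - + 1 * sign k * a + sign k * + b)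
                                                               (cong +_ (nCk+nC[k+1]≡[n+1]C[k+1] (m ℕ.+ suc k) k))
                                                               (cong (λ x → x C k) (ℕP.+-suc m k)) ⟩
  choose -[1+ suc m ] (+ suc k) + choose -[1+ suc m ] (+ k) ∎
  where
  open ≡-Reasoning
  A = (m ℕ.+ suc k) C k
  B = (m ℕ.+ suc k) C suc k
  regroup : ∀ x a b → - + 1 * x * b ≡ - + 1 * x * (a + b) + x * a
  regroup = solve-∀

pascal⁻ : ∀ n k → choose n k ≡ choose (n - + 1) k + choose (n - + 1) (k - + 1)
pascal⁻ n k = trans (cong (λ x → choose x k) (predSucc n)) (pascal (n - + 1) k)
  where
  predSucc : ∀ n → n ≡ n - + 1 + + 1
  predSucc = solve-∀

binomial-factorials : ∀ a m → ((a ℕ.+ m) C a) ℕ.* (a ! ℕ.* m !) ≡ (a ℕ.+ m) !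
binomial-factorials a m = begin
  ((a ℕ.+ m) C a) ℕ.* (a ! ℕ.* m !)                   ≡⟨ cong (λ x → ((a ℕ.+ m) C a) ℕ.* (a ! ℕ.* x !)) (sym a+m∸a) ⟩
  ((a ℕ.+ m) C a) ℕ.* d                               ≡⟨ cong (ℕ._* d) (nCk≡n!/k![n-k]! a≤) ⟩
  (a ℕ.+ m) ! ℕ./ d ℕ.* d                           ≡⟨ m/n*n≡m (k![n∸k]!∣n! a≤) ⟩
  (a ℕ.+ m) !                                       ∎
  where
  open ≡-Reasoning
  d = a ! ℕ.* ((a ℕ.+ m) ℕ.∸ a) !
  instance _ = a !* ((a ℕ.+ m) ℕ.∸ a) !≢0
  a≤ = ℕP.m≤m+n a m
  a+m∸a = ℕP.m+n∸m≡n a m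

divide-out : ∀ q d .{{_ : ℕ.NonZero d}} → (n : ℕ) → n ≡ q ℕ.* d → n ℕ./ d ≡ q
divide-out q d n n≡qd = trans (/-congˡ n≡qd) (m*n/n≡m q d)

multinomial₂ : ∀ a b → multinomial (+ a ∷ + b ∷ []) ≡ + ((a ℕ.+ b) C a)
multinomial₂ a b = cong +_ (divide-out ((a ℕ.+ b) C a) (a ! ℕ.* (b ! ℕ.* 1)) _ (begin
  (a ℕ.+ (b ℕ.+ 0)) !                     ≡⟨ cong (λ x → (a ℕ.+ x) !) (ℕP.+-identityʳ b) ⟩
  (a ℕ.+ b) !                             ≡⟨ sym (binomial-factorials a b) ⟩
  ((a ℕ.+ b) C a) ℕ.* (a ! ℕ.* b !)         ≡⟨ cong (λ x → ((a ℕ.+ b) C a) ℕ.* (a ! ℕ.* x)) (sym (ℕP.*-identityʳ (b !))) ⟩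
  ((a ℕ.+ b) C a) ℕ.* (a ! ℕ.* (b ! ℕ.* 1)) ∎))
  where
  open ≡-Reasoning
  instance _ = prodFact≢0 (a ∷ b ∷ [])

multinomial₃ : ∀ a b c → multinomial (+ a ∷ + b ∷ + c ∷ []) ≡ + (((a ℕ.+ (b ℕ.+ c)) C a) ℕ.* ((b ℕ.+ c) C b))
multinomial₃ a b c = cong +_ (divide-out (C₁ ℕ.* C₂) (a ! ℕ.* (b ! ℕ.* (c ! ℕ.* 1))) _ (begin
  (a ℕ.+ (b ℕ.+ (c ℕ.+ 0))) !                 ≡⟨ cong (λ x → (a ℕ.+ (b ℕ.+ x)) !) (ℕP.+-identityʳ c) ⟩
  (a ℕ.+ (b ℕ.+ c)) !                         ≡⟨ sym (binomial-factorials a (b ℕ.+ c)) ⟩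
  C₁ ℕ.* (a ! ℕ.* (b ℕ.+ c) !)                ≡⟨ cong (λ x → C₁ ℕ.* (a ! ℕ.* x)) (sym (binomial-factorials b c)) ⟩
  C₁ ℕ.* (a ! ℕ.* (C₂ ℕ.* (b ! ℕ.* c !)))     ≡⟨ regroup C₁ C₂ (a !) (b !) (c !) ⟩
  C₁ ℕ.* C₂ ℕ.* (a ! ℕ.* (b ! ℕ.* (c ! ℕ.* 1))) ∎))
  where
  open ≡-Reasoning
  instance _ = prodFact≢0 (a ∷ b ∷ c ∷ [])
  C₁ = (a ℕ.+ (b ℕ.+ c)) C a
  C₂ = (b ℕ.+ c) C b
  regroup : ∀ p q x y z → p ℕ.* (x ℕ.* (q ℕ.* (y ℕ.* z))) ≡ p ℕ.* q ℕ.* (x ℕ.* (y ℕ.* (z ℕ.* 1)))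
  regroup = ℕSolver.solve-∀

below : ∀ a y m → + a + -[1+ y ] ≡ + m → m ℕ.< a
below a y m h = subst (m ℕ.<_) (sym (ℤP.+-injective a≡m+1+y)) (ℕP.m<m+n m (ℕ.s≤s ℕ.z≤n))
  where
  addBack : ∀ a y → a ≡ (a + - y) + y
  addBack = solve-∀
  a≡m+1+y : + a ≡ + (m ℕ.+ suc y)
  a≡m+1+y = trans (addBack (+ a) (+ suc y)) (cong (_+ + suc y) h)

binomial≡choose : ∀ n r → + 0 ≤ n → binomial n r ≡ choose n r
binomial≡choose (+ m) -[1+ _ ] _ = refl
binomial≡choose (+ m) (+ a) _ = complement (+ m - + a) (a+[m-a]≡m (+ a) (+ m))
  where
  a+[m-a]≡m : ∀ a m → a + (m - a) ≡ m
  a+[m-a]≡m = solve-∀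
  complement : ∀ r → + a + r ≡ + m → multinomial (+ a ∷ r ∷ []) ≡ choose (+ m) (+ a)
  complement (+ b)    h = trans (multinomial₂ a b) (cong (λ x → + (x C a)) (ℤP.+-injective h))
  complement -[1+ y ] h = sym (choose-above m a (below a y m h))

multinomial≡choose : ∀ t e p q → e + p + q ≡ t → + 0 ≤ t →
                     multinomial (e ∷ p ∷ q ∷ []) ≡ choose t e * choose (t - e) p
multinomial≡choose (+ n) -[1+ _ ] p q _ _ = refl
multinomial≡choose (+ n) (+ a) -[1+ _ ] q _ _ = sym (ℤP.*-zeroʳ (+ (n C a)))
multinomial≡choose (+ n) (+ a) (+ b) -[1+ z ] h _ with + n - + a in eq
... | + m = sym (trans (cong (λ x → + (n C a) * + x) (k>n⇒nCk≡0 (below b z m b+q≡m))) (ℤP.*-zeroʳ (+ (n C a))))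
  where
  drop : ∀ a b q n → a + b + q ≡ n → b + q ≡ n - a
  drop a b q n h = trans (rearrange a b q) (cong (_- a) h)
    where
    rearrange : ∀ a b q → b + q ≡ a + b + q - a
    rearrange = solve-∀
  b+q≡m : + b + -[1+ z ] ≡ + m
  b+q≡m = trans (drop (+ a) (+ b) -[1+ z ] (+ n) h) eq
... | -[1+ y ] = sym (trans (cong (_* choose -[1+ y ] (+ b)) (choose-above n a (below a y n a+r≡n))) (ℤP.*-zeroˡ (choose -[1+ y ] (+ b))))
  where
  a+[n-a]≡n : ∀ a n → a + (n - a) ≡ n
  a+[n-a]≡n = solve-∀
  a+r≡n : + a + -[1+ y ] ≡ + n
  a+r≡n = trans (cong (_+_ (+ a)) (sym eq)) (a+[n-a]≡n (+ a) (+ n))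
multinomial≡choose (+ n) (+ a) (+ b) (+ c) h _ = begin
  multinomial (+ a ∷ + b ∷ + c ∷ [])                   ≡⟨ multinomial₃ a b c ⟩
  + (((a ℕ.+ (b ℕ.+ c)) C a) ℕ.* ((b ℕ.+ c) C b))         ≡⟨ ℤP.pos-* ((a ℕ.+ (b ℕ.+ c)) C a) ((b ℕ.+ c) C b) ⟩
  + ((a ℕ.+ (b ℕ.+ c)) C a) * + ((b ℕ.+ c) C b)       ≡⟨ cong₂ (λ x y → + (x C a) * choose y (+ b)) total rest ⟩
  choose (+ n) (+ a) * choose (+ n - + a) (+ b)       ∎
  where
  open ≡-Reasoning
  total : a ℕ.+ (b ℕ.+ c) ≡ n
  total = trans (sym (ℕP.+-assoc a b c)) (ℤP.+-injective h)
  rearrange : ∀ a b c → b + c ≡ a + b + c - a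
  rearrange = solve-∀
  rest : + (b ℕ.+ c) ≡ + n - + a
  rest = trans (rearrange (+ a) (+ b) (+ c)) (cong (_- + a) h)

kernelTerm : ℤ → ℤ → ℤ → ℤ → ℤ → ℤ → ℤ
kernelTerm t U V A G n = choose (t + n) n * choose U (G - n) * choose V (A - n)

kernel : ℕ → ℤ → ℤ → ℤ → ℤ → ℤ → ℤ
kernel N t U V A G = ∑ (+ 0) N (kernelTerm t U V A G)

kernel-swap : ∀ N t U V A G → kernel N t U V A G ≡ kernel N t V U G A
kernel-swap N t U V A G = ∑-ext (+ 0) N (λ n → swap (choose (t + n) n) (choose U (G - n)) (choose V (A - n)))
  where
  swap : ∀ a b c → a * b * c ≡ a * c * b
  swap = solve-∀

kernel-pascalU : ∀ N t U U' V A G G' → U' ≡ U - + 1 → G' ≡ G - + 1 →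
                 kernel N t U' V A G ≡ kernel N t U V A G - kernel N t U' V A G'
kernel-pascalU N t U U' V A G G' refl refl =
  trans (∑-ext (+ 0) N termwise) (∑-- (+ 0) N _ _)
  where
  shift : ∀ G n → G - n - + 1 ≡ G - + 1 - n
  shift = solve-∀
  difference : ∀ c x y v → c * x * v ≡ c * (x + y) * v - c * y * v
  difference = solve-∀
  termwise : ∀ n → kernelTerm t U' V A G n ≡ kernelTerm t U V A G n - kernelTerm t U' V A G' n
  termwise n = begin
    c * choose U' (G - n) * v                                          ≡⟨ difference c (choose U' (G - n)) (choose U' (G' - n)) v ⟩
    c * (choose U' (G - n) + choose U' (G' - n)) * v - c * choose U' (G' - n) * v
      ≡⟨ cong (λ x → c * x * v - c * choose U' (G' - n) * v)
              (sym (trans (pascal⁻ U (G - n)) (cong (_+_ (choose U' (G - n))) (cong (choose U') (shift G n))))) ⟩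
    c * choose U (G - n) * v - c * choose U' (G' - n) * v              ∎
    where
    open ≡-Reasoning
    c = choose (t + n) n
    v = choose V (A - n)

kernel-pascalV : ∀ N t U V V' A A' G → V' ≡ V - + 1 → A' ≡ A - + 1 →
                 kernel N t U V' A G ≡ kernel N t U V A G - kernel N t U V' A' G
kernel-pascalV N t U V V' A A' G hV hA = begin
  kernel N t U V' A G                              ≡⟨ kernel-swap N t U V' A G ⟩
  kernel N t V' U G A                              ≡⟨ kernel-pascalU N t V V' U G A A' hV hA ⟩
  kernel N t V U G A - kernel N t V' U G A'        ≡⟨ sym (cong₂ _-_ (kernel-swap N t U V A G) (kernel-swap N t U V' A' G)) ⟩
  kernel N t U V A G - kernel N t U V' A' G        ∎
  where open ≡-Reasoning

-- Pascal's rule in t:  K_t(A, G) - K_{t-1}(A, G) = K_t(A-1, G-1), provided the term of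
-- index N that the shift n ↦ n+1 brings into range vanishes.
kernel-pascalT : ∀ N t t' U V A A' G G' → t' ≡ t - + 1 → A' ≡ A - + 1 → G' ≡ G - + 1 →
                 choose V (A - + N) ≡ + 0 →
                 kernel N t U V A G - kernel N t' U V A G ≡ kernel N t U V A' G'
kernel-pascalT N t t' U V A A' G G' refl refl refl lastVanishes = begin
  kernel N t U V A G - kernel N t' U V A G                         ≡⟨ sym (∑-- (+ 0) N _ _) ⟩
  ∑ (+ 0) N (λ n → kernelTerm t U V A G n - kernelTerm t' U V A G n) ≡⟨ ∑-ext (+ 0) N difference ⟩
  ∑ (+ 0) N Y                                                      ≡⟨ sym (∑-up (+ 0) N Y refl atN) ⟩
  ∑ (+ 0) N (λ n → Y (n + + 1))                                    ≡⟨ ∑-ext (+ 0) N shifted ⟩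
  kernel N t U V A' G'                                             ∎
  where
  open ≡-Reasoning
  -- The difference of the two summands, by Pascal's rule for C(t+n, n).
  Y : ℤ → ℤ
  Y n = choose (t' + n) (n - + 1) * choose U (G - n) * choose V (A - n)
  pred+ : ∀ t n → t + n - + 1 ≡ t - + 1 + n
  pred+ = solve-∀
  cancel : ∀ a b x y → (a + b) * x * y - a * x * y ≡ b * x * y
  cancel = solve-∀
  difference : ∀ n → kernelTerm t U V A G n - kernelTerm t' U V A G n ≡ Y n
  difference n = begin
    choose (t + n) n * x * y - choose (t' + n) n * x * y
      ≡⟨ cong (λ z → z * x * y - choose (t' + n) n * x * y)
              (trans (pascal⁻ (t + n) n) (cong (λ w → choose w n + choose w (n - + 1)) (pred+ t n))) ⟩
    (choose (t' + n) n + choose (t' + n) (n - + 1)) * x * y - choose (t' + n) n * x * y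
      ≡⟨ cancel (choose (t' + n) n) (choose (t' + n) (n - + 1)) x y ⟩
    Y n ∎
    where
    x = choose U (G - n)
    y = choose V (A - n)
  index : ∀ A N → A - (+ 0 + N) ≡ A - N
  index = solve-∀
  atN : Y (+ 0 + + N) ≡ + 0
  atN = trans (cong (_*_ front) (trans (cong (choose V) (index A (+ N))) lastVanishes)) (ℤP.*-zeroʳ front)
    where front = choose (t' + (+ 0 + + N)) (+ 0 + + N - + 1) * choose U (G - (+ 0 + + N))
  pred+succ : ∀ t n → t - + 1 + (n + + 1) ≡ t + n
  pred+succ = solve-∀
  succPred : ∀ n → n + + 1 - + 1 ≡ n
  succPred = solve-∀
  minusSucc : ∀ G n → G - (n + + 1) ≡ G - + 1 - n
  minusSucc = solve-∀
  shifted : ∀ n → Y (n + + 1) ≡ kernelTerm t U V (A - + 1) (G - + 1) n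
  shifted n = cong₃ (λ a b c → a * choose U b * choose V c)
                    (cong₂ choose (pred+succ t n) (succPred n)) (minusSucc G n) (minusSucc A n)

swapDifference : ∀ a b c → a - b ≡ c → a - c ≡ b
swapDifference a b c h = trans (cong (_-_ a) (sym h)) (cancelTwice a b)
  where
  cancelTwice : ∀ a b → a - (a - b) ≡ b
  cancelTwice = solve-∀
addBack : ∀ a b c → a ≡ b - c → b ≡ a + c
addBack a b c h = trans (sym (subtractAdd b c)) (cong (_+ c) (sym h))
  where
  subtractAdd : ∀ b c → b - c + c ≡ b
  subtractAdd = solve-∀

κ : ℕ → ℤ → ℤ → ℤ → ℤ → ℤ → ℤ
κ N t l d α γ = kernel N t (t - d + γ - α) (l + d - γ + α) α γ

-- Writing u, v for the upper indices of κ_t(α,γ), all six auxiliary kernels W₀…W₅ below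
-- live at level t; Pascal's rule in U and V links them to the left-hand side and
-- Pascal's rule in t to the right-hand side.
κ-recurrence : ∀ N t l d α γ →
  choose (l + d - γ + α) (α - + N) ≡ + 0 →
  choose (l + (d - + 1) - (γ - + 1) + (α + + 1)) (α + + 1 - + N) ≡ + 0 →
  κ N t l d α γ + κ N t l d (α + + 1) (γ - + 1) - + 2 * κ N t l d α (γ - + 1)
    ≡ κ N (t - + 1) l d α γ + κ N (t - + 1) l (d - + 1) (α + + 1) (γ - + 1)
κ-recurrence N t l d α γ vanish₁ vanish₂ = begin
  X + Y - + 2 * Z                          ≡⟨ cong₂ (λ a b → a + b - + 2 * Z) X≡W₀+W₁ Y≡W₃+W₅ ⟩
  (W₀ + W₁) + (W₃ + W₅) - + 2 * Z          ≡⟨ cong₂ (λ a b → (W₀ + a) + (W₃ + b) - + 2 * Z) W₁≡Z-W₂ W₅≡Z-W₄ ⟩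
  (W₀ + (Z - W₂)) + (W₃ + (Z - W₄)) - + 2 * Z ≡⟨ collect W₀ W₂ W₃ W₄ Z ⟩
  (W₀ - W₂) + (W₃ - W₄)                    ≡⟨ cong₂ _+_ W₀-W₂≡P W₃-W₄≡Q ⟩
  P + Q                                    ∎
  where
  open ≡-Reasoning
  u = t - d + γ - α
  v = l + d - γ + α
  u' = t - + 1 - (d - + 1) + (γ - + 1) - (α + + 1)
  v' = l + (d - + 1) - (γ - + 1) + (α + + 1)
  X = κ N t l d α γ
  Y = κ N t l d (α + + 1) (γ - + 1)
  Z = κ N t l d α (γ - + 1)
  P = κ N (t - + 1) l d α γ
  Q = κ N (t - + 1) l (d - + 1) (α + + 1) (γ - + 1)
  U₀ = t - + 1 - d + γ - α
  W₀ = kernel N t U₀ v α γ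
  W₁ = kernel N t U₀ v α (γ - + 1)
  W₂ = kernel N t U₀ v (α - + 1) (γ - + 1)
  W₃ = kernel N t u' v' (α + + 1) (γ - + 1)
  W₄ = kernel N t u' v' α (γ - + 1 - + 1)
  W₅ = kernel N t u' v' α (γ - + 1)
  collect : ∀ w₀ w₂ w₃ w₄ z → (w₀ + (z - w₂)) + (w₃ + (z - w₄)) - + 2 * z ≡ (w₀ - w₂) + (w₃ - w₄)
  collect = solve-∀
  succPred : ∀ α → α ≡ α + + 1 - + 1
  succPred = solve-∀
  lowerU : ∀ t d γ α → t - + 1 - d + γ - α ≡ (t - d + γ - α) - + 1
  lowerU = solve-∀
  lowerU' : ∀ t d γ α → t - + 1 - (d - + 1) + (γ - + 1) - (α + + 1) ≡ t - + 1 - d + γ - α - + 1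
  lowerU' = solve-∀
  lowerV₁ : ∀ l d γ α → l + d - γ + α ≡ l + d - (γ - + 1) + α - + 1
  lowerV₁ = solve-∀
  lowerV₂ : ∀ l d γ α → l + (d - + 1) - (γ - + 1) + (α + + 1) ≡ l + d - (γ - + 1) + (α + + 1) - + 1
  lowerV₂ = solve-∀
  sameU₁ : ∀ t d γ α → t - d + (γ - + 1) - α ≡ t - + 1 - d + γ - α
  sameU₁ = solve-∀
  sameU₂ : ∀ t d γ α → t - d + (γ - + 1) - (α + + 1) ≡ t - + 1 - (d - + 1) + (γ - + 1) - (α + + 1)
  sameU₂ = solve-∀
  sameV : ∀ l d γ α → l + (d - + 1) - (γ - + 1) + (α + + 1) ≡ l + d - (γ - + 1) + α
  sameV = solve-∀
  W₀-W₂≡P : W₀ - W₂ ≡ P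
  W₀-W₂≡P = swapDifference W₀ P W₂ (kernel-pascalT N t (t - + 1) U₀ v α (α - + 1) γ (γ - + 1) refl refl refl vanish₁)
  W₃-W₄≡Q : W₃ - W₄ ≡ Q
  W₃-W₄≡Q = swapDifference W₃ Q W₄ (kernel-pascalT N t (t - + 1) u' v' (α + + 1) α (γ - + 1) (γ - + 1 - + 1)
                              refl (succPred α) refl vanish₂)
  X≡W₀+W₁ : X ≡ W₀ + W₁
  X≡W₀+W₁ = addBack W₀ X W₁ (kernel-pascalU N t u U₀ v α γ (γ - + 1) (lowerU t d γ α) refl)
  Y≡W₃+W₅ : Y ≡ W₃ + W₅
  Y≡W₃+W₅ = addBack W₃ Y W₅ (trans (kernel-pascalV N t u' (l + d - (γ - + 1) + (α + + 1)) v' (α + + 1) α (γ - + 1)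
                                            (lowerV₂ l d γ α) (succPred α))
                           (cong (λ z → kernel N t z (l + d - (γ - + 1) + (α + + 1)) (α + + 1) (γ - + 1) - W₅) (sym (sameU₂ t d γ α))))
  W₁≡Z-W₂ : W₁ ≡ Z - W₂
  W₁≡Z-W₂ = trans (kernel-pascalV N t U₀ (l + d - (γ - + 1) + α) v α (α - + 1) (γ - + 1) (lowerV₁ l d γ α) refl)
                  (cong (λ z → kernel N t z (l + d - (γ - + 1) + α) α (γ - + 1) - W₂) (sym (sameU₁ t d γ α)))
  W₅≡Z-W₄ : W₅ ≡ Z - W₄
  W₅≡Z-W₄ = trans (kernel-pascalU N t U₀ u' v' α (γ - + 1) (γ - + 1 - + 1) (lowerU' t d γ α) refl)
                  (cong₂ (λ z w → kernel N t z w α (γ - + 1) - W₄) (sym (sameU₁ t d γ α)) (sameV l d γ α))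

-- The negative integer -(1+m), written so that ring normalisation produces it.
negative : ℕ → ℤ
negative m = - (+ 1 + + m)

trinomial : ℤ → ℤ → ℤ → ℤ
trinomial t e p = choose t e * choose (t - e) p

-- Pascal's rule for trinomial coefficients: remove one element from one of the three blocks.
trinomial-pascal : ∀ t e p → trinomial t e p ≡
  trinomial (t - + 1) (e - + 1) p + trinomial (t - + 1) e (p - + 1) + trinomial (t - + 1) e p
trinomial-pascal t e p = begin
  choose t e * choose (t - e) p
    ≡⟨ cong₂ _*_ (pascal⁻ t e) (trans (pascal⁻ (t - e) p) (cong₂ (λ x y → choose x p + choose y (p - + 1)) (swap t e) (swap t e))) ⟩
  (A + A₁) * (choose (t - + 1 - e) p + choose (t - + 1 - e) (p - + 1))
    ≡⟨ expand A A₁ (choose (t - + 1 - e) p) (choose (t - + 1 - e) (p - + 1)) ⟩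
  A₁ * (choose (t - + 1 - e) p + choose (t - + 1 - e) (p - + 1)) + A * choose (t - + 1 - e) (p - + 1) + A * choose (t - + 1 - e) p
    ≡⟨ cong (λ z → A₁ * z + A * choose (t - + 1 - e) (p - + 1) + A * choose (t - + 1 - e) p)
         (sym (trans (pascal⁻ (t - + 1 - (e - + 1)) p) (cong₂ (λ x y → choose x p + choose x (p - + 1)) (same t e) (same t e)))) ⟩
  A₁ * choose (t - + 1 - (e - + 1)) p + A * choose (t - + 1 - e) (p - + 1) + A * choose (t - + 1 - e) p ∎
  where
  open ≡-Reasoning
  A = choose (t - + 1) e
  A₁ = choose (t - + 1) (e - + 1)
  swap : ∀ t e → t - e - + 1 ≡ t - + 1 - e
  swap = solve-∀
  same : ∀ t e → t - + 1 - (e - + 1) - + 1 ≡ t - + 1 - e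
  same = solve-∀
  expand : ∀ a a₁ x y → (a + a₁) * (x + y) ≡ a₁ * (x + y) + a * y + a * x
  expand = solve-∀

kernel-negativeG : ∀ N t U V A G m → G ≡ negative m → kernel N t U V A G ≡ + 0
kernel-negativeG N t U V A G m refl = ∑-vanish (+ 0) N _ termVanishes
  where
  lower : ∀ m i → - (+ 1 + m) - (+ 0 + i) ≡ - (+ 1 + (m + i))
  lower = solve-∀
  termVanishes : ∀ i → i ℕ.< N → kernelTerm t U V A (negative m) (+ 0 + + i) ≡ + 0
  termVanishes i _ = product-vanishesᵐ (choose (t + n) n) (choose U (negative m - n)) (choose V (A - n))
                                       (cong (choose U) (lower (+ m) (+ i)))
    where n = + 0 + + i

κ-negativeγ : ∀ N t l d α γ m → γ ≡ negative m → κ N t l d α γ ≡ + 0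
κ-negativeγ N t l d α γ = kernel-negativeG N t (t - d + γ - α) (l + d - γ + α) α γ

-- For A = 0 only the term n = 0 survives: K(t; U, V; 0, G) = C(U, G).
kernel-A≡0 : ∀ N t U V G → kernel (suc N) t U V (+ 0) G ≡ choose U G
kernel-A≡0 N t U V G = begin
  kernelTerm t U V (+ 0) G (+ 0) + ∑ (+ 0 + + 1) N (kernelTerm t U V (+ 0) G)
    ≡⟨ cong₂ _+_ first (∑-vanish (+ 1) N _ (λ i _ → rest i)) ⟩
  choose U G + + 0
    ≡⟨ ℤP.+-identityʳ _ ⟩
  choose U G ∎
  where
  open ≡-Reasoning
  unit : ∀ x → + 1 * x * + 1 ≡ x
  unit = solve-∀
  first : kernelTerm t U V (+ 0) G (+ 0) ≡ choose U G
  first = trans (cong₃ (λ x y z → x * choose U y * z) (choose-zero (t + + 0)) (ℤP.+-identityʳ G) (choose-zero V))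
                (unit (choose U G))
  lower : ∀ (x : ℤ) → + 0 - (+ 1 + x) ≡ - (+ 1 + x)
  lower = solve-∀
  rest : ∀ i → kernelTerm t U V (+ 0) G (+ 1 + + i) ≡ + 0
  rest i = product-vanishesʳ (choose (t + n) n) (choose U (G - n)) (choose V (+ 0 - n)) (cong (choose V) (lower (+ i)))
    where n = + 1 + + i

term : ℕ → ℤ → ℤ → ℤ → ℤ → ℤ → ℤ
term N t l d α γ = pow-2 (l - α - γ) * trinomial t (l - α - γ) (α + d) * κ N t l d α γ

-- The main sum  S(t, l, d) = Σ_{0 ≤ α, γ ≤ l+1} term(α, γ)  with l + 3 kernel terms; terms
-- with α + γ > l vanish, the extra row and column make room for index shifts.
mainSum : ℕ → ℤ → ℤ → ℤ
mainSum l' t d = ∑∑ (suc (suc l')) (term (suc (suc (suc l'))) t (+ l') d)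

term-vanishes : ∀ N t l d α γ r → l - α - γ ≡ negative r → term N t l d α γ ≡ + 0
term-vanishes N t l d α γ r e≡- =
  product-vanishesᵐ (pow-2 (l - α - γ)) (trinomial t (l - α - γ) (α + d)) (κ N t l d α γ)
                    (cong (λ e → trinomial t e (α + d)) e≡-)

-- (-2)^{E+1} = -2 · (-2)^E, in front of a factor m that vanishes when E < 0.
pow-2-succ : ∀ E m → (∀ k → E ≡ -[1+ k ] → m ≡ + 0) → pow-2 (E + + 1) * m ≡ - + 2 * (pow-2 E * m)
pow-2-succ (+ k) m _ = trans (cong (λ n → (- + 2) ℤ.^ n * m) (ℕP.+-comm k 1)) (ℤP.*-assoc (- + 2) (pow-2 (+ k)) m)
pow-2-succ -[1+ k ] m vanishes rewrite vanishes k refl =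
  trans (ℤP.*-zeroʳ (pow-2 (-[1+ k ] + + 1))) (sym (cong (_*_ (- + 2)) (ℤP.*-zeroʳ (pow-2 -[1+ k ]))))

-- Splitting the trinomial coefficient by Pascal's rule writes S(t, l, d) as ΣP₁ + ΣP₂ + ΣP₃.
-- Re-indexing P₁ by γ ↦ γ-1 and P₂ - T₂ by (α, γ) ↦ (α+1, γ-1) (T₂ being the summand of
-- S(t-1, l, d-1)) aligns every piece with the summand T₁ of S(t-1, l, d) at the same point,
-- where they cancel by the recurrence of κ.
module PascalStep (l' : ℕ) (t d : ℤ) where

  B N : ℕ
  B = suc (suc l')
  N = suc B
  l t' : ℤ
  l = + l'
  t' = t - + 1

  B≡l+2 : + B ≡ l + + 2
  B≡l+2 = cong +_ (ℕP.+-comm 2 l')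

  e : ℤ → ℤ → ℤ
  e α γ = l - α - γ

  P₁ P₂ P₃ T₁ T₂ Q : ℤ → ℤ → ℤ
  P₁ α γ = pow-2 (e α γ) * trinomial t' (e α γ - + 1) (α + d) * κ N t l d α γ
  P₂ α γ = pow-2 (e α γ) * trinomial t' (e α γ) (α + d - + 1) * κ N t l d α γ
  P₃ α γ = pow-2 (e α γ) * trinomial t' (e α γ) (α + d) * κ N t l d α γ
  T₁ = term N t' l d
  T₂ = term N t' l (d - + 1)
  Q α γ = P₂ α γ - T₂ α γ

  splitByPascal : mainSum l' t d ≡ ∑∑ B P₁ + ∑∑ B P₂ + ∑∑ B P₃
  splitByPascal = trans (∑∑-ext B _ _ termwise)
                        (trans (∑∑-+ B (λ a c → P₁ a c + P₂ a c) P₃) (cong (_+ ∑∑ B P₃) (∑∑-+ B P₁ P₂)))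
    where
    distribute : ∀ w a b c x → w * (a + b + c) * x ≡ w * a * x + w * b * x + w * c * x
    distribute = solve-∀
    termwise : ∀ α γ → term N t l d α γ ≡ P₁ α γ + P₂ α γ + P₃ α γ
    termwise α γ = trans (cong (λ z → pow-2 (e α γ) * z * κ N t l d α γ) (trinomial-pascal t (e α γ) (α + d)))
                         (distribute (pow-2 (e α γ)) _ _ _ (κ N t l d α γ))

  -- In the column γ = -1 the kernels vanish, in the column γ = l + 1 the trinomials of
  -- P₁, P₂, T₂ do; in the row α = 0 the two parts of Q cancel, in the row α = l + 2 both
  -- trinomials vanish.
  γ₋₁ γₗ₊₁ : ℤ
  γ₋₁ = + 0 - + 1
  γₗ₊₁ = + 0 + + B - + 1

  e-lastColumn : ∀ i → e (+ 0 + + i) γₗ₊₁ ≡ negative i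
  e-lastColumn i = trans (cong (λ z → l - (+ 0 + + i) - (+ 0 + z - + 1)) B≡l+2) (normalise l (+ i))
    where
    normalise : ∀ (l i : ℤ) → l - (+ 0 + i) - (+ 0 + (l + + 2) - + 1) ≡ - (+ 1 + i)
    normalise = solve-∀

  e-lastRow : ∀ k → e (+ 0 + + B) (+ 0 + + k - + 1) ≡ negative k
  e-lastRow k = trans (cong (λ z → l - (+ 0 + z) - (+ 0 + + k - + 1)) B≡l+2) (normalise l (+ k))
    where
    normalise : ∀ (l k : ℤ) → l - (+ 0 + (l + + 2)) - (+ 0 + k - + 1) ≡ - (+ 1 + k)
    normalise = solve-∀

  P₁-shift : ∑∑ B P₁ ≡ ∑∑ B (λ α γ → P₁ α (γ - + 1))
  P₁-shift = ∑-cong (+ 0) B {λ α → ∑ (+ 0) B (P₁ α)} {λ α → ∑ (+ 0) B (λ γ → P₁ α (γ - + 1))}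
                     (λ i _ → sym (∑-down (+ 0) B (P₁ (+ 0 + + i)) (first (+ 0 + + i)) (last i)))
    where
    first : ∀ α → P₁ α γ₋₁ ≡ + 0
    first α = product-vanishesʳ (pow-2 (e α γ₋₁)) (trinomial t' (e α γ₋₁ - + 1) (α + d)) (κ N t l d α γ₋₁)
                                (κ-negativeγ N t l d α γ₋₁ 0 refl)
    last : ∀ i → P₁ (+ 0 + + i) γₗ₊₁ ≡ + 0
    last i = product-vanishesᵐ (pow-2 (e α γₗ₊₁)) (trinomial t' (e α γₗ₊₁ - + 1) (α + d)) (κ N t l d α γₗ₊₁)
                               (cong (λ x → trinomial t' x (α + d)) (trans (cong (_- + 1) (e-lastColumn i)) (pred (+ i))))
      where
      α = + 0 + + i
      pred : ∀ i → - (+ 1 + i) - + 1 ≡ - (+ 1 + (+ 1 + i))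
      pred = solve-∀

  Q-vanishes-lastColumn : ∀ i → Q (+ 0 + + i) γₗ₊₁ ≡ + 0
  Q-vanishes-lastColumn i = cong₂ _-_
    (product-vanishesᵐ (pow-2 (e α γₗ₊₁)) _ (κ N t l d α γₗ₊₁) (cong (λ x → trinomial t' x (α + d - + 1)) (e-lastColumn i)))
    (product-vanishesᵐ (pow-2 (e α γₗ₊₁)) _ (κ N t' l (d - + 1) α γₗ₊₁) (cong (λ x → trinomial t' x (α + (d - + 1))) (e-lastColumn i)))
    where α = + 0 + + i

  Q-vanishes-lastRow : ∀ γ k → γ ≡ + 0 + + k - + 1 → Q (+ 0 + + B) γ ≡ + 0
  Q-vanishes-lastRow γ k refl = cong₂ _-_
    (product-vanishesᵐ (pow-2 (e α γ)) _ (κ N t l d α γ) (cong (λ x → trinomial t' x (α + d - + 1)) (e-lastRow k)))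
    (product-vanishesᵐ (pow-2 (e α γ)) _ (κ N t' l (d - + 1) α γ) (cong (λ x → trinomial t' x (α + (d - + 1))) (e-lastRow k)))
    where α = + 0 + + B

  -- In the row α = 0 both kernels reduce to the same binomial coefficient C(t - d + γ, γ).
  Q-vanishes-firstRow : ∀ γ → Q (+ 0) γ ≡ + 0
  Q-vanishes-firstRow γ = trans (cong (_- T₂ (+ 0) γ) (cong₂ (λ x y → pow-2 (e (+ 0) γ) * trinomial t' (e (+ 0) γ) x * y)
                                                             (assoc d) sameKernel))
                                (ℤP.+-inverseʳ (T₂ (+ 0) γ))
    where
    assoc : ∀ (d : ℤ) → + 0 + d - + 1 ≡ + 0 + (d - + 1)
    assoc = solve-∀
    sameU : ∀ (t d γ : ℤ) → t - d + γ - + 0 ≡ t - + 1 - (d - + 1) + γ - + 0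
    sameU = solve-∀
    sameKernel : κ N t l d (+ 0) γ ≡ κ N t' l (d - + 1) (+ 0) γ
    sameKernel = trans (kernel-A≡0 B t (t - d + γ - + 0) (l + d - γ + + 0) γ)
                       (trans (cong (λ z → choose z γ) (sameU t d γ))
                              (sym (kernel-A≡0 B t' (t' - (d - + 1) + γ - + 0) (l + (d - + 1) - γ + + 0) γ)))

  Q-shift : ∑∑ B Q ≡ ∑∑ B (λ α γ → Q (α + + 1) (γ - + 1))
  Q-shift = trans shiftγ (sym (∑-up (+ 0) B column firstRow lastRow))
    where
    shiftγ : ∑∑ B Q ≡ ∑∑ B (λ α γ → Q α (γ - + 1))
    shiftγ = ∑-cong (+ 0) B {λ α → ∑ (+ 0) B (Q α)} {λ α → ∑ (+ 0) B (λ γ → Q α (γ - + 1))}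
               (λ i _ → sym (∑-down (+ 0) B (Q (+ 0 + + i)) (firstColumn (+ 0 + + i)) (Q-vanishes-lastColumn i)))
      where
      firstColumn : ∀ α → Q α γ₋₁ ≡ + 0
      firstColumn α = cong₂ _-_
        (product-vanishesʳ (pow-2 (e α γ₋₁)) _ (κ N t l d α γ₋₁) (κ-negativeγ N t l d α γ₋₁ 0 refl))
        (product-vanishesʳ (pow-2 (e α γ₋₁)) _ (κ N t' l (d - + 1) α γ₋₁) (κ-negativeγ N t' l (d - + 1) α γ₋₁ 0 refl))
    column : ℤ → ℤ
    column α = ∑ (+ 0) B (λ γ → Q α (γ - + 1))
    firstRow : column (+ 0) ≡ + 0
    firstRow = ∑-vanish (+ 0) B (λ γ → Q (+ 0) (γ - + 1)) (λ i _ → Q-vanishes-firstRow (+ 0 + + i - + 1))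
    lastRow : column (+ 0 + + B) ≡ + 0
    lastRow = ∑-vanish (+ 0) B (λ γ → Q (+ 0 + + B) (γ - + 1)) (λ k _ → Q-vanishes-lastRow (+ 0 + + k - + 1) k refl)

  F : ℤ → ℤ → ℤ
  F α γ = P₁ α (γ - + 1) + Q (α + + 1) (γ - + 1) + P₃ α γ - T₁ α γ

  F-vanishes : ∀ i → i ℕ.< B → ∀ γ → F (+ 0 + + i) γ ≡ + 0
  F-vanishes i i<B γ = begin
    F α γ                                                ≡⟨ cong₅ shape (r₁ l α γ) (r₂ l α γ) (r₃ l α γ) (r₄ α d) (r₅ α d) ⟩
    pow-2 (E + + 1) * m * X₁ + (w * Y - w * Q') + w * Z - w * P
                                                         ≡⟨ cong (λ z → z * X₁ + (w * Y - w * Q') + w * Z - w * P) (pow-2-succ E m mVanishes) ⟩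
    - + 2 * w * X₁ + (w * Y - w * Q') + w * Z - w * P    ≡⟨ factor w X₁ Y Q' Z P ⟩
    w * (Z + Y - + 2 * X₁) - w * (P + Q')                ≡⟨ cong (λ z → w * z - w * (P + Q')) (κ-recurrence N t l d α γ vanish₁ vanish₂) ⟩
    w * (P + Q') - w * (P + Q')                          ≡⟨ ℤP.+-inverseʳ (w * (P + Q')) ⟩
    + 0                                                  ∎
    where
    open ≡-Reasoning
    α = + 0 + + i
    E = l - α - γ
    m = trinomial t' E (α + d)
    w = pow-2 E * m
    X₁ = κ N t l d α (γ - + 1)
    Y = κ N t l d (α + + 1) (γ - + 1)
    Q' = κ N t' l (d - + 1) (α + + 1) (γ - + 1)
    Z = κ N t l d α γ
    P = κ N t' l d α γ
    shape : ℤ → ℤ → ℤ → ℤ → ℤ → ℤ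
    shape a b c p q = pow-2 a * trinomial t' b (α + d) * X₁ + (pow-2 c * trinomial t' c p * Y - pow-2 c * trinomial t' c q * Q')
                      + pow-2 E * m * Z - pow-2 E * m * P
    cong₅ : ∀ (f : ℤ → ℤ → ℤ → ℤ → ℤ → ℤ) {a b c p q a' b' c' p' q'} →
            a ≡ a' → b ≡ b' → c ≡ c' → p ≡ p' → q ≡ q' → f a b c p q ≡ f a' b' c' p' q'
    cong₅ f refl refl refl refl refl = refl
    r₁ : ∀ (l α γ : ℤ) → l - α - (γ - + 1) ≡ l - α - γ + + 1
    r₁ = solve-∀
    r₂ : ∀ (l α γ : ℤ) → l - α - (γ - + 1) - + 1 ≡ l - α - γ
    r₂ = solve-∀
    r₃ : ∀ (l α γ : ℤ) → l - (α + + 1) - (γ - + 1) ≡ l - α - γ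
    r₃ = solve-∀
    r₄ : ∀ (α d : ℤ) → α + + 1 + d - + 1 ≡ α + d
    r₄ = solve-∀
    r₅ : ∀ (α d : ℤ) → α + + 1 + (d - + 1) ≡ α + d
    r₅ = solve-∀
    factor : ∀ w x₁ y q z p → - + 2 * w * x₁ + (w * y - w * q) + w * z - w * p ≡ w * (z + y - + 2 * x₁) - w * (p + q)
    factor = solve-∀
    mVanishes : ∀ k → E ≡ -[1+ k ] → m ≡ + 0
    mVanishes k E≡- = cong (λ x → trinomial t' x (α + d)) E≡-
    -- The kernel terms of index N fall outside the support because α < B = N - 1.
    r = B ℕ.∸ suc i
    B≡1+i+r : + B ≡ + 1 + + i + + r
    B≡1+i+r = cong +_ (sym (ℕP.m+[n∸m]≡n i<B))
    beyond₁ : ∀ (i r : ℤ) → + 0 + i - (+ 1 + (+ 1 + i + r)) ≡ - (+ 1 + (+ 1 + r))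
    beyond₁ = solve-∀
    beyond₂ : ∀ (i r : ℤ) → + 0 + i + + 1 - (+ 1 + (+ 1 + i + r)) ≡ - (+ 1 + r)
    beyond₂ = solve-∀
    vanish₁ : choose (l + d - γ + α) (α - + N) ≡ + 0
    vanish₁ = cong (choose (l + d - γ + α)) (trans (cong (λ z → α - (+ 1 + z)) B≡1+i+r) (beyond₁ (+ i) (+ r)))
    vanish₂ : choose (l + (d - + 1) - (γ - + 1) + (α + + 1)) (α + + 1 - + N) ≡ + 0
    vanish₂ = cong (choose (l + (d - + 1) - (γ - + 1) + (α + + 1))) (trans (cong (λ z → α + + 1 - (+ 1 + z)) B≡1+i+r) (beyond₂ (+ i) (+ r)))

  mainSum-pascal : mainSum l' t d ≡ mainSum l' t' d + mainSum l' t' (d - + 1)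
  mainSum-pascal = begin
    mainSum l' t d                                       ≡⟨ splitByPascal ⟩
    ∑∑ B P₁ + ∑∑ B P₂ + ∑∑ B P₃                          ≡⟨ cong (λ z → z + ∑∑ B P₂ + ∑∑ B P₃) P₁-shift ⟩
    a + ∑∑ B P₂ + c                                      ≡⟨ regroup a (∑∑ B P₂) c d₁ d₂ ⟩
    (a + (∑∑ B P₂ - d₂) + c - d₁) + (d₁ + d₂)            ≡⟨ cong (λ z → (a + z + c - d₁) + (d₁ + d₂)) (sym shiftedQ) ⟩
    (a + b + c - d₁) + (d₁ + d₂)                         ≡⟨ cong (_+ (d₁ + d₂)) (trans (sym linear) cancelled) ⟩
    + 0 + (d₁ + d₂)                                      ≡⟨ ℤP.+-identityˡ _ ⟩
    d₁ + d₂                                              ∎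
    where
    open ≡-Reasoning
    a = ∑∑ B (λ α γ → P₁ α (γ - + 1))
    b = ∑∑ B (λ α γ → Q (α + + 1) (γ - + 1))
    c = ∑∑ B P₃
    d₁ = ∑∑ B T₁
    d₂ = ∑∑ B T₂
    regroup : ∀ a p c d₁ d₂ → a + p + c ≡ (a + (p - d₂) + c - d₁) + (d₁ + d₂)
    regroup = solve-∀
    shiftedQ : b ≡ ∑∑ B P₂ - d₂
    shiftedQ = trans (sym Q-shift) (∑∑-- B P₂ T₂)
    linear : ∑∑ B F ≡ a + b + c - d₁
    linear = trans (∑∑-- B (λ α γ → P₁ α (γ - + 1) + Q (α + + 1) (γ - + 1) + P₃ α γ) T₁)
                   (cong (_- d₁) (trans (∑∑-+ B (λ α γ → P₁ α (γ - + 1) + Q (α + + 1) (γ - + 1)) P₃)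
                                        (cong (_+ c) (∑∑-+ B (λ α γ → P₁ α (γ - + 1)) (λ α γ → Q (α + + 1) (γ - + 1))))))
    cancelled : ∑∑ B F ≡ + 0
    cancelled = ∑-vanish (+ 0) B (λ α → ∑ (+ 0) B (F α))
                  (λ i i<B → ∑-vanish (+ 0) B (F (+ 0 + + i)) (λ k _ → F-vanishes i i<B (+ 0 + + k)))

choose-symmetric : ∀ a i → choose (+ a) (+ a - + i) ≡ choose (+ a) (+ i)
choose-symmetric a i with ℕP.≤-<-connex i a
... | inj₁ i≤a = begin
  choose (+ a) (+ a - + i)            ≡⟨ cong (λ z → choose (+ a) (+ z - + i)) (sym i+r≡a) ⟩
  choose (+ a) (+ i + + r - + i)      ≡⟨ cong (choose (+ a)) (cancel (+ i) (+ r)) ⟩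
  + (a C (a ℕ.∸ i))                   ≡⟨ cong +_ (sym (nCk≡nC[n∸k] i≤a)) ⟩
  + (a C i)                           ∎
  where
  open ≡-Reasoning
  r = a ℕ.∸ i
  i+r≡a : i ℕ.+ r ≡ a
  i+r≡a = ℕP.m+[n∸m]≡n i≤a
  cancel : ∀ (i r : ℤ) → i + r - i ≡ r
  cancel = solve-∀
... | inj₂ a<i = trans (cong (λ z → choose (+ a) (+ a - z)) (cong +_ (sym a+1+r≡i)))
                       (trans (cong (choose (+ a)) (negativeDifference (+ a) (+ r))) (sym (choose-above a i a<i)))
  where
  r = i ℕ.∸ suc a
  a+1+r≡i : suc a ℕ.+ r ≡ i
  a+1+r≡i = ℕP.m+[n∸m]≡n a<i
  negativeDifference : ∀ (a r : ℤ) → a - (+ 1 + a + r) ≡ - (+ 1 + r)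
  negativeDifference = solve-∀

-- C(0, x) is the Kronecker delta δ_{x,0}; summing against it picks out one term.
∑-δ-before : ∀ lo m c (f : ℤ → ℤ) → ∑ lo c (λ k → choose (+ 0) (lo - (+ 1 + + m) - k) * f k) ≡ + 0
∑-δ-before lo m c f = ∑-vanish lo c _ (λ i _ → cong (λ z → choose (+ 0) z * f (lo + + i)) (normalise lo (+ m) (+ i)))
  where
  normalise : ∀ lo m i → lo - (+ 1 + m) - (lo + i) ≡ - (+ 1 + (m + i))
  normalise = solve-∀

∑-δ-after : ∀ lo m c (f : ℤ → ℤ) → ∑ lo c (λ k → choose (+ 0) (lo + + c + + m - k) * f k) ≡ + 0
∑-δ-after lo m c f = ∑-vanish lo c _ (λ i i<c → cong (λ z → choose (+ 0) z * f (lo + + i))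
    (trans (cong (λ z → lo + z + + m - (lo + + i)) (cong +_ (sym (ℕP.m+[n∸m]≡n i<c))))
           (normalise lo (+ i) (+ (c ℕ.∸ suc i)) (+ m))))
  where
  normalise : ∀ lo i r m → lo + (+ 1 + i + r) + m - (lo + i) ≡ + 1 + (r + m)
  normalise = solve-∀

∑-δ : ∀ lo n c (f : ℤ → ℤ) → n ℕ.< c → ∑ lo c (λ k → choose (+ 0) (lo + + n - k) * f k) ≡ f (lo + + n)
∑-δ lo zero (suc c) f _ = begin
  choose (+ 0) (lo + + 0 - lo) * f lo + ∑ (lo + + 1) c (λ k → choose (+ 0) (lo + + 0 - k) * f k)
    ≡⟨ cong₂ _+_ (cong (λ z → choose (+ 0) z * f lo) (cancel lo)) rest ⟩
  + 1 * f lo + + 0   ≡⟨ trans (ℤP.+-identityʳ _) (ℤP.*-identityˡ _) ⟩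
  f lo               ≡⟨ cong f (sym (ℤP.+-identityʳ lo)) ⟩
  f (lo + + 0)       ∎
  where
  open ≡-Reasoning
  cancel : ∀ lo → lo + + 0 - lo ≡ + 0
  cancel = solve-∀
  before : ∀ lo k → lo + + 0 - k ≡ lo + + 1 - (+ 1 + + 0) - k
  before = solve-∀
  rest : ∑ (lo + + 1) c (λ k → choose (+ 0) (lo + + 0 - k) * f k) ≡ + 0
  rest = trans (∑-ext (lo + + 1) c (λ k → cong (λ z → choose (+ 0) z * f k) (before lo k))) (∑-δ-before (lo + + 1) 0 c f)
∑-δ lo (suc n) (suc c) f (ℕ.s≤s n<c) = begin
  choose (+ 0) (lo + + suc n - lo) * f lo + ∑ (lo + + 1) c (λ k → choose (+ 0) (lo + + suc n - k) * f k)
    ≡⟨ cong₂ _+_ (cong (λ z → choose (+ 0) z * f lo) (cancel lo (+ suc n)))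
                 (∑-ext (lo + + 1) c (λ k → cong (λ z → choose (+ 0) (z - k) * f k) (sym (+1+ lo n)))) ⟩
  + 0 * f lo + ∑ (lo + + 1) c (λ k → choose (+ 0) (lo + + 1 + + n - k) * f k)
    ≡⟨ cong (_+_ (+ 0 * f lo)) (∑-δ (lo + + 1) n c f n<c) ⟩
  + 0 + f (lo + + 1 + + n)  ≡⟨ ℤP.+-identityˡ _ ⟩
  f (lo + + 1 + + n)        ≡⟨ cong f (+1+ lo n) ⟩
  f (lo + + suc n)          ∎
  where
  open ≡-Reasoning
  cancel : ∀ lo x → lo + x - lo ≡ x
  cancel = solve-∀

vandermonde : ∀ N' g a k m → k - + suc N' ≡ negative m →
              ∑ (+ 0) (suc N') (λ n → choose (+ g) n * choose (+ a) (k - n)) ≡ choose (+ (g ℕ.+ a)) k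
vandermonde N' zero a k m _ = begin
  choose (+ 0) (+ 0) * choose (+ a) (k - + 0) + ∑ (+ 0 + + 1) N' (λ n → choose (+ 0) n * choose (+ a) (k - n))
    ≡⟨ cong₂ _+_ (trans (ℤP.*-identityˡ _) (cong (choose (+ a)) (ℤP.+-identityʳ k))) (∑-vanish (+ 1) N' _ (λ i _ → refl)) ⟩
  choose (+ a) k + + 0  ≡⟨ ℤP.+-identityʳ _ ⟩
  choose (+ a) k        ∎
  where open ≡-Reasoning
vandermonde N' (suc g) a k m k-N≡- = begin
  ∑ (+ 0) N (λ n → choose (+ suc g) n * choose (+ a) (k - n))
    ≡⟨ ∑-ext (+ 0) N split ⟩
  ∑ (+ 0) N (λ n → choose (+ g) n * choose (+ a) (k - n) + Y (n - + 1))
    ≡⟨ ∑-+ (+ 0) N (λ n → choose (+ g) n * choose (+ a) (k - n)) (λ n → Y (n - + 1)) ⟩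
  ∑ (+ 0) N (λ n → choose (+ g) n * choose (+ a) (k - n)) + ∑ (+ 0) N (λ n → Y (n - + 1))
    ≡⟨ cong (_+_ (∑ (+ 0) N (λ n → choose (+ g) n * choose (+ a) (k - n)))) (∑-down (+ 0) N Y refl Y-last) ⟩
  ∑ (+ 0) N (λ n → choose (+ g) n * choose (+ a) (k - n)) + ∑ (+ 0) N Y
    ≡⟨ cong₂ _+_ (vandermonde N' g a k m k-N≡-) (vandermonde N' g a (k - + 1) (suc m) k-1-N≡-) ⟩
  choose (+ (g ℕ.+ a)) k + choose (+ (g ℕ.+ a)) (k - + 1)
    ≡⟨ sym (pascal (+ (g ℕ.+ a)) k) ⟩
  choose (+ (g ℕ.+ a) + + 1) k
    ≡⟨ cong (λ z → choose (+ z) k) (ℕP.+-comm (g ℕ.+ a) 1) ⟩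
  choose (+ (suc g ℕ.+ a)) k ∎
  where
  open ≡-Reasoning
  N = suc N'
  Y : ℤ → ℤ
  Y n = choose (+ g) n * choose (+ a) (k - + 1 - n)
  reindex : ∀ k n → k - n ≡ k - + 1 - (n - + 1)
  reindex = solve-∀
  distrib : ∀ x y z → (x + y) * z ≡ x * z + y * z
  distrib = solve-∀
  split : ∀ n → choose (+ suc g) n * choose (+ a) (k - n) ≡ choose (+ g) n * choose (+ a) (k - n) + Y (n - + 1)
  split n = begin
    choose (+ suc g) n * choose (+ a) (k - n)                                 ≡⟨ cong (λ z → choose (+ z) n * choose (+ a) (k - n)) (ℕP.+-comm 1 g) ⟩
    choose (+ g + + 1) n * choose (+ a) (k - n)                               ≡⟨ cong (_* choose (+ a) (k - n)) (pascal (+ g) n) ⟩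
    (choose (+ g) n + choose (+ g) (n - + 1)) * choose (+ a) (k - n)
      ≡⟨ distrib (choose (+ g) n) (choose (+ g) (n - + 1)) (choose (+ a) (k - n)) ⟩
    choose (+ g) n * choose (+ a) (k - n) + choose (+ g) (n - + 1) * choose (+ a) (k - n)
      ≡⟨ cong (λ z → choose (+ g) n * choose (+ a) (k - n) + choose (+ g) (n - + 1) * choose (+ a) z) (reindex k n) ⟩
    choose (+ g) n * choose (+ a) (k - n) + Y (n - + 1)                       ∎
  last : ∀ k N → k - + 1 - (+ 0 + N - + 1) ≡ k - N
  last = solve-∀
  Y-last : Y (+ 0 + + N - + 1) ≡ + 0
  Y-last = trans (cong (_*_ (choose (+ g) n₀)) (cong (choose (+ a)) (trans (last k (+ N)) k-N≡-)))
                 (ℤP.*-zeroʳ (choose (+ g) n₀))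
    where n₀ = + 0 + + N - + 1
  shift : ∀ k N → k - + 1 - N ≡ k - N - + 1
  shift = solve-∀
  pred : ∀ m → - (+ 1 + m) - + 1 ≡ - (+ 1 + (+ 1 + m))
  pred = solve-∀
  k-1-N≡- : k - + 1 - + N ≡ negative (suc m)
  k-1-N≡- = trans (shift k (+ N)) (trans (cong (_- + 1) k-N≡-) (pred (+ m)))

-- At t = 0 the kernel attached to the single surviving point is a Vandermonde sum:
--   K_0(g, a; a, g) = Σ_n C(a, n) C(g, g-n) = C(a+g, g).
kernel-t≡0 : ∀ N' g a m → + g - + suc N' ≡ negative m →
             kernel (suc N') (+ 0) (+ g) (+ a) (+ a) (+ g) ≡ choose (+ (a ℕ.+ g)) (+ g)
kernel-t≡0 N' g a m g-N≡- =
  trans (∑-cong (+ 0) (suc N') {kernelTerm (+ 0) (+ g) (+ a) (+ a) (+ g)} {λ n → choose (+ a) n * choose (+ g) (+ g - n)}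
                (λ i _ → subst (λ n → kernelTerm (+ 0) (+ g) (+ a) (+ a) (+ g) n ≡ choose (+ a) n * choose (+ g) (+ g - n))
                               (sym (ℤP.+-identityˡ (+ i))) (termwise i)))
        (vandermonde N' a g (+ g) m g-N≡-)
  where
  reorder : ∀ x y → + 1 * x * y ≡ y * x
  reorder = solve-∀
  termwise : ∀ i → kernelTerm (+ 0) (+ g) (+ a) (+ a) (+ g) (+ i) ≡ choose (+ a) (+ i) * choose (+ g) (+ g - + i)
  termwise i = trans (cong₂ (λ u v → + u * choose (+ g) (+ g - + i) * v) (nCn≡1 i) (choose-symmetric a i))
                     (reorder (choose (+ g) (+ g - + i)) (choose (+ a) (+ i)))

choose-0-negate : ∀ k → choose (+ 0) k ≡ choose (+ 0) (- k)
choose-0-negate (+ zero)  = refl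
choose-0-negate (+ suc n) = refl
choose-0-negate -[1+ n ]  = refl

-- The base case t = 0:  S(0, l, d) = C(l, l + d).  The trinomial coefficient
-- C(0; l-α-γ, α+d) forces γ = l - α and α = -d, leaving the single kernel of kernel-t≡0.
module BaseCase (l' : ℕ) (d : ℤ) where

  B N : ℕ
  B = suc (suc l')
  N = suc B
  l : ℤ
  l = + l'

  reduced : ℤ → ℤ → ℤ
  reduced α γ = pow-2 (l - α - γ) * choose (+ 0 - (l - α - γ)) (α + d) * κ N (+ 0) l d α γ

  diagonal : ℤ → ℤ
  diagonal α = κ N (+ 0) l d α (l - α)

  pullOut : ∀ p a b c → p * (a * b) * c ≡ a * (p * b * c)
  pullOut = solve-∀

  rowSum : ∀ i → i ℕ.< B → ∑ (+ 0) B (term N (+ 0) l d (+ 0 + + i)) ≡ choose (+ 0) (+ 0 + + i + d) * diagonal (+ 0 + + i)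
  rowSum i i<B with ℕP.≤-<-connex i l'
  ... | inj₁ i≤l' = begin
    ∑ (+ 0) B (term N (+ 0) l d α)
      ≡⟨ ∑-ext (+ 0) B (λ γ → trans (pullOut (pow-2 (l - α - γ)) (choose (+ 0) (l - α - γ)) _ (κ N (+ 0) l d α γ))
                                      (cong (λ z → choose (+ 0) (z - γ) * reduced α γ) l-α≡n)) ⟩
    ∑ (+ 0) B (λ γ → choose (+ 0) (+ 0 + + n - γ) * reduced α γ)   ≡⟨ ∑-δ (+ 0) n B (reduced α) n<B ⟩
    reduced α (+ 0 + + n)                                           ≡⟨ cong (reduced α) (sym l-α≡n) ⟩
    reduced α (l - α)                                               ≡⟨ cong (λ z → pow-2 z * choose (+ 0 - z) (α + d) * diagonal α) (cancel l α) ⟩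
    + 1 * choose (+ 0) (α + d) * diagonal α                   ≡⟨ cong (_* diagonal α) (ℤP.*-identityˡ (choose (+ 0) (α + d))) ⟩
    choose (+ 0) (α + d) * diagonal α                         ∎
    where
    open ≡-Reasoning
    α = + 0 + + i
    n = l' ℕ.∸ i
    n<B : n ℕ.< B
    n<B = ℕ.s≤s (ℕP.m≤n⇒m≤1+n (ℕP.m∸n≤m l' i))
    difference : ∀ (i n : ℤ) → i + n - (+ 0 + i) ≡ + 0 + n
    difference = solve-∀
    l-α≡n : l - α ≡ + 0 + + n
    l-α≡n = trans (cong (λ z → + z - α) (sym (ℕP.m+[n∸m]≡n i≤l'))) (difference (+ i) (+ n))
    cancel : ∀ (l α : ℤ) → l - α - (l - α) ≡ + 0
    cancel = solve-∀
  ... | inj₂ l'<i = begin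
    ∑ (+ 0) B (term N (+ 0) l d α)
      ≡⟨ ∑-ext (+ 0) B (λ γ → trans (pullOut (pow-2 (l - α - γ)) (choose (+ 0) (l - α - γ)) _ (κ N (+ 0) l d α γ))
                                      (cong (λ z → choose (+ 0) (z - γ) * reduced α γ) l-α≡-1)) ⟩
    ∑ (+ 0) B (λ γ → choose (+ 0) (+ 0 - (+ 1 + + 0) - γ) * reduced α γ)   ≡⟨ ∑-δ-before (+ 0) 0 B (reduced α) ⟩
    + 0                                                                ≡⟨ sym (ℤP.*-zeroʳ (choose (+ 0) (α + d))) ⟩
    choose (+ 0) (α + d) * + 0
      ≡⟨ cong (_*_ (choose (+ 0) (α + d))) (sym (κ-negativeγ N (+ 0) l d α (l - α) 0 l-α≡-1)) ⟩
    choose (+ 0) (α + d) * diagonal α                                  ∎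
    where
    open ≡-Reasoning
    α = + 0 + + i
    i≡l'+1 : i ≡ suc l'
    i≡l'+1 = ℕP.≤-antisym (ℕP.≤-pred i<B) l'<i
    normalise : ∀ (l : ℤ) → l - (+ 0 + (+ 1 + l)) ≡ + 0 - (+ 1 + + 0)
    normalise = solve-∀
    l-α≡-1 : l - α ≡ + 0 - (+ 1 + + 0)
    l-α≡-1 = trans (cong (λ z → l - (+ 0 + + z)) i≡l'+1) (normalise l)

  collapse : mainSum l' (+ 0) d ≡ ∑ (+ 0) B (λ α → choose (+ 0) (- d - α) * diagonal α)
  collapse = trans (∑-cong (+ 0) B {λ α → ∑ (+ 0) B (term N (+ 0) l d α)} {λ α → choose (+ 0) (α + d) * diagonal α} rowSum)
                   (∑-ext (+ 0) B (λ α → cong (_* diagonal α) (trans (choose-0-negate (α + d)) (cong (choose (+ 0)) (negate α d)))))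
    where
    negate : ∀ α d → - (α + d) ≡ - d - α
    negate = solve-∀

  -- For d > 0 no row meets α = -d, and C(l, l + d) = 0.
  positive-d : ∀ m → d ≡ + suc m → mainSum l' (+ 0) d ≡ choose l (l + d)
  positive-d m refl = begin
    mainSum l' (+ 0) d                                                   ≡⟨ collapse ⟩
    ∑ (+ 0) B (λ α → choose (+ 0) (- d - α) * diagonal α)
      ≡⟨ ∑-ext (+ 0) B (λ α → cong (λ z → choose (+ 0) z * diagonal α) (normalise (+ m) α)) ⟩
    ∑ (+ 0) B (λ α → choose (+ 0) (+ 0 - (+ 1 + + m) - α) * diagonal α)  ≡⟨ ∑-δ-before (+ 0) m B diagonal ⟩
    + 0                                                                  ≡⟨ sym (choose-above l' (l' ℕ.+ suc m) (ℕP.m<m+n l' (ℕ.s≤s ℕ.z≤n))) ⟩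
    choose l (l + d)                                                     ∎
    where
    open ≡-Reasoning
    normalise : ∀ m α → - (+ 1 + m) - α ≡ + 0 - (+ 1 + m) - α
    normalise = solve-∀

  -- For d = -a with a > l + 1 no row meets α = a, and l + d < 0.
  very-negative-d : ∀ a → d ≡ - (+ a) → B ℕ.≤ a → mainSum l' (+ 0) d ≡ choose l (l + d)
  very-negative-d a refl B≤a = begin
    mainSum l' (+ 0) d                                                   ≡⟨ collapse ⟩
    ∑ (+ 0) B (λ α → choose (+ 0) (- d - α) * diagonal α)
      ≡⟨ ∑-ext (+ 0) B (λ α → cong (λ z → choose (+ 0) z * diagonal α) (index α)) ⟩
    ∑ (+ 0) B (λ α → choose (+ 0) (+ 0 + + B + + m - α) * diagonal α)    ≡⟨ ∑-δ-after (+ 0) m B diagonal ⟩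
    + 0
      ≡⟨ sym (cong (choose l) (trans (cong (λ z → l + - + z) (sym B+m≡a)) (l+d≡- l (+ m)))) ⟩
    choose l (l + d)                                                     ∎
    where
    open ≡-Reasoning
    m = a ℕ.∸ B
    B+m≡a : B ℕ.+ m ≡ a
    B+m≡a = ℕP.m+[n∸m]≡n B≤a
    normalise : ∀ (B m α : ℤ) → - (- (B + m)) - α ≡ + 0 + B + m - α
    normalise = solve-∀
    index : ∀ α → - d - α ≡ + 0 + + B + + m - α
    index α = trans (cong (λ z → - - + z - α) (sym B+m≡a)) (normalise (+ B) (+ m) α)
    l+d≡- : ∀ (l m : ℤ) → l + - (+ 1 + (+ 1 + l) + m) ≡ - (+ 1 + (+ 1 + m))
    l+d≡- = solve-∀

  -- For d = -a with 0 ≤ a ≤ l + 1 only the row α = a survives.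
  small-negative-d : ∀ a → d ≡ - (+ a) → a ℕ.≤ suc l' → mainSum l' (+ 0) d ≡ choose l (l + d)
  small-negative-d a refl a≤l'+1 = begin
    mainSum l' (+ 0) d                                          ≡⟨ collapse ⟩
    ∑ (+ 0) B (λ α → choose (+ 0) (- d - α) * diagonal α)      ≡⟨ ∑-ext (+ 0) B (λ α → cong (λ z → choose (+ 0) z * diagonal α) (normalise (+ a) α)) ⟩
    ∑ (+ 0) B (λ α → choose (+ 0) (+ 0 + + a - α) * diagonal α) ≡⟨ ∑-δ (+ 0) a B diagonal (ℕ.s≤s a≤l'+1) ⟩
    diagonal (+ 0 + + a)                                        ≡⟨ diagonal-a ⟩
    kernel N (+ 0) (l - + a) (+ a) (+ a) (l - + a)              ≡⟨ diagonalKernel ⟩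
    choose l (l + d)                                            ∎
    where
    open ≡-Reasoning
    normalise : ∀ (a α : ℤ) → - (- a) - α ≡ + 0 + a - α
    normalise = solve-∀
    upperU : ∀ (a l : ℤ) → + 0 - - a + (l - (+ 0 + a)) - (+ 0 + a) ≡ l - a
    upperU = solve-∀
    upperV : ∀ (a l : ℤ) → l + - a - (l - (+ 0 + a)) + (+ 0 + a) ≡ a
    upperV = solve-∀
    lowerG : ∀ (a l : ℤ) → l - (+ 0 + a) ≡ l - a
    lowerG = solve-∀
    diagonal-a : diagonal (+ 0 + + a) ≡ kernel N (+ 0) (l - + a) (+ a) (+ a) (l - + a)
    diagonal-a = trans (cong₂ (λ u v → kernel N (+ 0) u v (+ 0 + + a) (l - (+ 0 + + a))) (upperU (+ a) l) (upperV (+ a) l))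
                       (cong₂ (kernel N (+ 0) (l - + a) (+ a)) (ℤP.+-identityˡ (+ a)) (lowerG (+ a) l))
    diagonalKernel : kernel N (+ 0) (l - + a) (+ a) (+ a) (l - + a) ≡ choose l (l + d)
    diagonalKernel with ℕP.≤-<-connex a l'
    ... | inj₁ a≤l' = begin
      kernel N (+ 0) (l - + a) (+ a) (+ a) (l - + a)  ≡⟨ cong (λ z → kernel N (+ 0) z (+ a) (+ a) z) l-a≡g ⟩
      kernel N (+ 0) (+ g) (+ a) (+ a) (+ g)          ≡⟨ kernel-t≡0 B g a (suc (suc a)) g-N≡- ⟩
      choose (+ (a ℕ.+ g)) (+ g)                      ≡⟨ cong₂ (λ x y → choose (+ x) y) a+g≡l' (sym l-a≡g) ⟩
      choose l (l + d)                                ∎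
      where
      g = l' ℕ.∸ a
      a+g≡l' : a ℕ.+ g ≡ l'
      a+g≡l' = ℕP.m+[n∸m]≡n a≤l'
      cancel : ∀ (a g : ℤ) → a + g - a ≡ g
      cancel = solve-∀
      l-a≡g : l - + a ≡ + g
      l-a≡g = trans (cong (λ z → + z - + a) (sym a+g≡l')) (cancel (+ a) (+ g))
      beyond : ∀ (a g : ℤ) → g - (+ 1 + (+ 1 + (+ 1 + (a + g)))) ≡ - (+ 1 + (+ 1 + (+ 1 + a)))
      beyond = solve-∀
      g-N≡- : + g - + suc B ≡ negative (suc (suc a))
      g-N≡- = trans (cong (λ z → + g - (+ 1 + (+ 1 + (+ 1 + + z)))) (sym a+g≡l')) (beyond (+ a) (+ g))
    ... | inj₂ l'<a = trans (kernel-negativeG N (+ 0) (l - + a) (+ a) (+ a) (l - + a) r l-a≡-)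
                            (sym (cong (choose l) l-a≡-))
      where
      r = a ℕ.∸ suc l'
      l'+1+r≡a : suc l' ℕ.+ r ≡ a
      l'+1+r≡a = ℕP.m+[n∸m]≡n l'<a
      normalise' : ∀ (l r : ℤ) → l - (+ 1 + l + r) ≡ - (+ 1 + r)
      normalise' = solve-∀
      l-a≡- : l - + a ≡ negative r
      l-a≡- = trans (cong (λ z → l - + z) (sym l'+1+r≡a)) (normalise' l (+ r))

mainSum-at-0 : ∀ l' d → mainSum l' (+ 0) d ≡ choose (+ l') (+ l' + d)
mainSum-at-0 l' (+ zero)  = BaseCase.small-negative-d l' (+ 0) 0 refl ℕ.z≤n
mainSum-at-0 l' (+ suc m) = BaseCase.positive-d l' (+ suc m) m refl
mainSum-at-0 l' -[1+ m ] with ℕP.≤-<-connex (suc m) (suc l')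
... | inj₁ a≤l'+1 = BaseCase.small-negative-d l' -[1+ m ] (suc m) refl a≤l'+1
... | inj₂ l'+1<a  = BaseCase.very-negative-d l' -[1+ m ] (suc m) refl l'+1<a

mainSum-closedForm : ∀ l' t' d → mainSum l' (+ t') d ≡ choose (+ t' + + l') (+ l' + d)
mainSum-closedForm l' zero d = mainSum-at-0 l' d
mainSum-closedForm l' (suc t') d = begin
  mainSum l' (+ suc t') d                                      ≡⟨ PascalStep.mainSum-pascal l' (+ suc t') d ⟩
  mainSum l' (+ t') d + mainSum l' (+ t') (d - + 1)            ≡⟨ cong₂ _+_ (mainSum-closedForm l' t' d) (mainSum-closedForm l' t' (d - + 1)) ⟩
  choose (+ t' + l) (l + d) + choose (+ t' + l) (l + (d - + 1)) ≡⟨ cong (λ k → choose (+ t' + l) (l + d) + choose (+ t' + l) k) (assoc l d) ⟩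
  choose (+ t' + l) (l + d) + choose (+ t' + l) (l + d - + 1)   ≡⟨ sym (pascal (+ t' + l) (l + d)) ⟩
  choose (+ t' + l + + 1) (l + d)                              ≡⟨ cong (λ z → choose (+ z) (l + d)) (ℕP.+-comm (t' ℕ.+ l') 1) ⟩
  choose (+ suc t' + l) (l + d)                                ∎
  where
  open ≡-Reasoning
  l = + l'
  assoc : ∀ (l d : ℤ) → l + (d - + 1) ≡ l + d - + 1
  assoc = solve-∀

IsNat : ℤ → Set
IsNat x = Σ ℕ (λ n → x ≡ + n)

IsNat⇒0≤ : ∀ {x} → IsNat x → + 0 ≤ x
IsNat⇒0≤ (n , refl) = ℤ.+≤+ ℕ.z≤n

count-nonneg : ∀ n → ∣ + n ⊔ + 0 ∣ ≡ n
count-nonneg n = ℕP.⊔-identityʳ n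

count-nonpos : ∀ r → ∣ - (+ r) ⊔ + 0 ∣ ≡ 0
count-nonpos zero    = refl
count-nonpos (suc r) = refl

half-double : ∀ n → (n ℕ.+ n) ℕ./ 2 ≡ n
half-double n = trans (cong (ℕ._/ 2) (trans (cong (n ℕ.+_) (sym (ℕP.+-identityʳ n))) (ℕP.*-comm 2 n))) (m*n/n≡m n 2)

positivePart-pos : ∀ k → (+ k) ₊ ≡ + k
positivePart-pos k = cong +_ (half-double k)

negativePart-pos : ∀ k → (+ k) ₋ ≡ + 0
negativePart-pos k = cong (_/ℕ 2) (ℤP.+-inverseʳ (+ k))

positivePart-neg : ∀ k → -[1+ k ] ₊ ≡ + 0
positivePart-neg k = cong (_/ℕ 2) (ℤP.+-inverseʳ (+ suc k))

negativePart-neg : ∀ k → -[1+ k ] ₋ ≡ + suc k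
negativePart-neg k = cong +_ (half-double (suc k))

trinomial-support : ∀ {t} → IsNat t → ∀ e p → trinomial t e p ≡ + 0 ⊎ (IsNat e × IsNat p × IsNat (t - e - p))
trinomial-support {t} _ -[1+ _ ] p = inj₁ refl
trinomial-support {t} _ (+ a) -[1+ _ ] = inj₁ (ℤP.*-zeroʳ (choose t (+ a)))
trinomial-support (n , refl) (+ a) (+ b) with + n - + a - + b in eq
... | + c      = inj₂ ((a , refl) , (b , refl) , (c , refl))
... | -[1+ z ] = inj₁ (sym (multinomial≡choose (+ n) (+ a) (+ b) -[1+ z ] sum≡n (ℤ.+≤+ ℕ.z≤n)))
  where
  addBack' : ∀ a b n → a + b + (n - a - b) ≡ n
  addBack' = solve-∀
  sum≡n : + a + + b + -[1+ z ] ≡ + n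
  sum≡n = trans (cong (λ w → + a + + b + w) (sym eq)) (addBack' (+ a) (+ b) (+ n))

betaSum≡kernel : ∀ c N t U V A G → IsNat t → IsNat U → IsNat V →
  (∀ i → c ℕ.≤ i → choose U (G - + i) * choose V (A - + i) ≡ + 0) →
  (∀ i → N ℕ.≤ i → choose U (G - + i) * choose V (A - + i) ≡ + 0) →
  ∑ (+ 0) c (λ n → binomial U (G - n) * binomial V (A - n) * binomial (t + n) n) ≡ kernel N t U V A G
betaSum≡kernel c N t U V A G (t₀ , refl) natU natV beyondC beyondN =
  trans (∑-cong (+ 0) c (λ i _ → termwise (+ 0 + + i) i refl))
        (∑-extend₂ c N (kernelTerm t U V A G) (λ i c≤i → vanishes i (beyondC i c≤i)) (λ i N≤i → vanishes i (beyondN i N≤i)))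
  where
  rotate : ∀ a b c → a * b * c ≡ c * a * b
  rotate = solve-∀
  reassoc : ∀ a b c → a * b * c ≡ a * (b * c)
  reassoc = solve-∀
  termwise : ∀ n i → n ≡ + 0 + + i →
             binomial U (G - n) * binomial V (A - n) * binomial (t + n) n ≡ kernelTerm t U V A G n
  termwise n i refl =
    trans (cong₃ (λ x y z → x * y * z) (binomial≡choose U (G - n) (IsNat⇒0≤ natU)) (binomial≡choose V (A - n) (IsNat⇒0≤ natV))
                                       (binomial≡choose (t + n) n (ℤ.+≤+ ℕ.z≤n)))
          (rotate (choose U (G - n)) (choose V (A - n)) (choose (t + n) n))
  vanishes : ∀ i → choose U (G - + i) * choose V (A - + i) ≡ + 0 → kernelTerm t U V A G (+ i) ≡ + 0
  vanishes i h = trans (reassoc (choose (t + + i) (+ i)) (choose U (G - + i)) (choose V (A - + i)))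
                       (trans (cong (_*_ (choose (t + + i) (+ i))) h) (ℤP.*-zeroʳ (choose (t + + i) (+ i))))

n≤1+2⌊n/2⌋ : ∀ n → n ℕ.≤ suc ((n ℕ./ 2) ℕ.+ (n ℕ./ 2))
n≤1+2⌊n/2⌋ n = begin
  n                              ≡⟨ m≡m%n+[m/n]*n n 2 ⟩
  n ℕ.% 2 ℕ.+ (n ℕ./ 2) ℕ.* 2    ≤⟨ ℕP.+-monoˡ-≤ ((n ℕ./ 2) ℕ.* 2) (ℕP.≤-pred (m%n<n n 2)) ⟩
  1 ℕ.+ (n ℕ./ 2) ℕ.* 2          ≡⟨ cong suc (trans (ℕP.*-comm (n ℕ./ 2) 2) (cong ((n ℕ./ 2) ℕ.+_) (ℕP.+-identityʳ _))) ⟩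
  suc ((n ℕ./ 2) ℕ.+ (n ℕ./ 2))  ∎
  where open ℕP.≤-Reasoning

count-half : ∀ q → ∣ + (q ℕ.+ 0) + + 1 ⊔ + 0 ∣ ≡ suc q
count-half q = trans (count-nonneg _) (trans (cong (ℕ._+ 1) (ℕP.+-identityʳ q)) (ℕP.+-comm q 1))

double-mono : ∀ q i' n → n ℕ.≤ suc (q ℕ.+ q) → q ℕ.≤ i' → n ℕ.≤ i' ℕ.+ suc i'
double-mono q i' n n≤ q≤i' = ℕP.≤-trans n≤ (ℕP.≤-trans (ℕ.s≤s (ℕP.+-mono-≤ q≤i' q≤i')) (ℕP.≤-reflexive (sym (ℕP.+-suc i' i'))))

beyond-⌊l-1/2⌋ : ∀ l' i → ∣ (⌊ + l' - + 1 /2⌋ - + 0) + + 1 ⊔ + 0 ∣ ℕ.≤ i → l' ℕ.≤ i ℕ.+ i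
beyond-⌊l-1/2⌋ zero i _ = ℕ.z≤n
beyond-⌊l-1/2⌋ (suc l'') zero h with subst (ℕ._≤ 0) (count-half (l'' ℕ./ 2)) h
... | ()
beyond-⌊l-1/2⌋ (suc l'') (suc i') h =
  ℕ.s≤s (double-mono (l'' ℕ./ 2) i' l'' (n≤1+2⌊n/2⌋ l'') (ℕP.≤-pred (subst (ℕ._≤ suc i') (count-half (l'' ℕ./ 2)) h)))

beyond-⌊l/2⌋ : ∀ l' i → ∣ (⌊ + l' /2⌋ - + 0) + + 1 ⊔ + 0 ∣ ℕ.≤ i → suc l' ℕ.≤ i ℕ.+ i
beyond-⌊l/2⌋ l' zero h with subst (ℕ._≤ 0) (count-half (l' ℕ./ 2)) h
... | ()
beyond-⌊l/2⌋ l' (suc i') h =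
  ℕ.s≤s (double-mono (l' ℕ./ 2) i' l' (n≤1+2⌊n/2⌋ l') (ℕP.≤-pred (subst (ℕ._≤ suc i') (count-half (l' ℕ./ 2)) h)))

offDiagonalSummand : ℤ → ℤ → ℤ → ℤ → ℤ → ℤ
offDiagonalSummand s l j m i =
  pow-2 (i - + 2 * m)
  * ( multinomial ((i - + 2 * m) ∷ (j - l + m) ∷ (s - i - j + m) ∷ [])
        * β m s l (i + j - l) (l - i)
    + multinomial ((i - + 2 * m) ∷ (j - i + m) ∷ (s - l - j + m) ∷ [])
        * β m s l (l + j - i) (i - l))

diagonalSummand : ℤ → ℤ → ℤ → ℤ → ℤ
diagonalSummand s l j m =
  pow-2 (l - + 2 * m)
  * multinomial ((l - + 2 * m) ∷ (j - l + m) ∷ (s - l - j + m) ∷ [])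
  * β m s l j (+ 0)

paperSum : ℤ → ℤ → ℤ → ℤ
paperSum s l j = Σ[ + 0 to ⌊ l - + 1 /2⌋ ] (λ m → Σ[ + 2 * m to l - + 1 ] (offDiagonalSummand s l j m))
               + Σ[ + 0 to ⌊ l /2⌋ ] (diagonalSummand s l j)

-- Each summand of the theorem is a term of
-- the main sum: the diagonal summand m is term(m, m), the off-diagonal summand (m, i) with
-- i = l-1-k is term(m, m+1+k) + term(m+1+k, m).  Summing the square by hooks then turns
-- S(t, l, d) into the left-hand side.
module Translation (t' l' : ℕ) (j : ℤ) where

  s l t d : ℤ
  s = + t' + + l'
  l = + l'
  t = + t'
  d = j - l
  B N : ℕ
  B = suc (suc l')
  N = suc B

  T : ℤ → ℤ → ℤ
  T = term N t l d

  s-l≡t : ∀ (t l : ℤ) → t + l - l ≡ t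
  s-l≡t = solve-∀

  -- A summand of the theorem with trinomial and β already identified is a term of the main
  -- sum; c is the number of terms of β, which equals γ + 1 or α + 1.
  β-term≡term : ∀ α γ a₀ g₀ c U V → α ≡ + a₀ → γ ≡ + g₀ → (+ c ≡ γ + + 1 ⊎ + c ≡ α + + 1) →
    U ≡ t - d + γ - α → V ≡ l + d - γ + α →
    pow-2 (l - α - γ) * trinomial t (l - α - γ) (α + d)
      * ∑ (+ 0) c (λ n → binomial U (γ - n) * binomial V (α - n) * binomial (s - l + n) n)
    ≡ T α γ
  β-term≡term α γ a₀ g₀ c U V α≡ γ≡ c≡ U≡ V≡ with trinomial-support (t' , refl) (l - α - γ) (α + d)
  ... | inj₁ vanishes = trans (product-vanishesᵐ (pow-2 (l - α - γ)) _ _ vanishes)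
                              (sym (product-vanishesᵐ (pow-2 (l - α - γ)) _ (κ N t l d α γ) vanishes))
  ... | inj₂ ((e₀ , e≡) , (p₀ , p≡) , (q₀ , q≡)) =
    cong (_*_ (pow-2 (l - α - γ) * trinomial t (l - α - γ) (α + d)))
      (trans (betaSum≡kernel c N (s - l) U V α γ (t' , s-l≡t t l) natU natV beyondC beyondN)
             (cong₃ (λ x y z → kernel N x y z α γ) (s-l≡t t l) U≡ V≡))
    where
    decomposeU : ∀ (t d l α γ : ℤ) → t - d + γ - α ≡ (l - α - γ) + (t - (l - α - γ) - (α + d)) + γ
    decomposeU = solve-∀
    natU : IsNat U
    natU = e₀ ℕ.+ q₀ ℕ.+ g₀ , trans U≡ (trans (decomposeU t d l α γ) (cong₃ (λ x y z → x + y + z) e≡ q≡ γ≡))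
    decomposeV : ∀ (d l α γ : ℤ) → l + d - γ + α ≡ (l - α - γ) + α + (α + d)
    decomposeV = solve-∀
    natV : IsNat V
    natV = e₀ ℕ.+ a₀ ℕ.+ p₀ , trans V≡ (trans (decomposeV d l α γ) (cong₃ (λ x y z → x + y + z) e≡ α≡ p≡))
    belowZero : ∀ x c i → + c ≡ x + + 1 → c ℕ.≤ i → x - + i ≡ negative (i ℕ.∸ c)
    belowZero x c i c≡x+1 c≤i = trans (cong (λ z → x - + z) (sym (ℕP.m+[n∸m]≡n c≤i)))
                                      (trans (cong (λ z → x - (z + + (i ℕ.∸ c))) c≡x+1) (normalise x (+ (i ℕ.∸ c))))
      where
      normalise : ∀ (x r : ℤ) → x - (x + + 1 + r) ≡ - (+ 1 + r)
      normalise = solve-∀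
    beyondC : ∀ i → c ℕ.≤ i → choose U (γ - + i) * choose V (α - + i) ≡ + 0
    beyondC i c≤i = bySide c≡
      where
      bySide : + c ≡ γ + + 1 ⊎ + c ≡ α + + 1 → choose U (γ - + i) * choose V (α - + i) ≡ + 0
      bySide (inj₁ c≡γ+1) = cong (λ z → choose U z * choose V (α - + i)) (belowZero γ c i c≡γ+1 c≤i)
      bySide (inj₂ c≡α+1) = trans (cong (λ z → choose U (γ - + i) * choose V z) (belowZero α c i c≡α+1 c≤i))
                                  (ℤP.*-zeroʳ (choose U (γ - + i)))
    -- For i ≥ N > l + 2 the index α - i is negative, since α + γ ≤ l.
    normaliseN : ∀ (l α γ e r : ℤ) → l - α - γ ≡ e → α - (+ 1 + (+ 1 + (+ 1 + l))) - r ≡ - (+ 1 + (+ 1 + (+ 1 + (γ + (e + r)))))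
    normaliseN l α γ e r refl = normalise l α γ r
      where
      normalise : ∀ (l α γ r : ℤ) → α - (+ 1 + (+ 1 + (+ 1 + l))) - r ≡ - (+ 1 + (+ 1 + (+ 1 + (γ + (l - α - γ + r)))))
      normalise = solve-∀
    splitIndex : ∀ (x : ℤ) (n r : ℕ) → x - + (n ℕ.+ r) ≡ x - + n - + r
    splitIndex x n r = minusSum x (+ n) (+ r)
      where
      minusSum : ∀ (x n r : ℤ) → x - (n + r) ≡ x - n - r
      minusSum = solve-∀
    α-N-r≡- : ∀ r → α - + N - + r ≡ negative (suc (suc (g₀ ℕ.+ (e₀ ℕ.+ r))))
    α-N-r≡- r = trans (normaliseN l α γ (+ e₀) (+ r) e≡) (cong (λ z → - (+ 1 + (+ 1 + (+ 1 + (z + (+ e₀ + + r)))))) γ≡)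
    beyondN : ∀ i → N ℕ.≤ i → choose U (γ - + i) * choose V (α - + i) ≡ + 0
    beyondN i N≤i = subst (λ z → choose U (γ - + z) * choose V (α - + z) ≡ + 0) (ℕP.m+[n∸m]≡n N≤i)
                          (trans (cong (λ z → choose U (γ - + (N ℕ.+ r)) * choose V z) (trans (splitIndex α N r) (α-N-r≡- r)))
                                 (ℤP.*-zeroʳ (choose U (γ - + (N ℕ.+ r)))))
      where r = i ℕ.∸ N

  multinomial≡trinomial : ∀ e p q e' p' → e + p + q ≡ t → e ≡ e' → p ≡ p' →
                          multinomial (e ∷ p ∷ q ∷ []) ≡ trinomial t e' p'
  multinomial≡trinomial e p q e' p' sum≡t e≡ p≡ = trans (multinomial≡choose t e p q sum≡t (ℤ.+≤+ ℕ.z≤n)) (cong₂ (trinomial t) e≡ p≡)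

  diagonalSummand≡term : ∀ k → diagonalSummand s l j (+ k) ≡ T (+ k) (+ k)
  diagonalSummand≡term k =
    trans (cong₃ (λ x y z → pow-2 x * y * z) (l-2m l m)
                 (multinomial≡trinomial _ _ _ _ _ (trans (blocks l j m s) (s-l≡t t l)) (l-2m l m) (swap l j m)) βSum)
          (β-term≡term m m k k c (s - j) j refl refl (inj₁ c≡m+1) (upperU t l j m) (upperV l j m))
    where
    m = + k
    l-2m : ∀ (l m : ℤ) → l - + 2 * m ≡ l - m - m
    l-2m = solve-∀
    blocks : ∀ (l j m s : ℤ) → (l - + 2 * m) + (j - l + m) + (s - l - j + m) ≡ s - l
    blocks = solve-∀
    swap : ∀ (l j m : ℤ) → j - l + m ≡ m + (j - l)
    swap = solve-∀
    upperU : ∀ (t l j m : ℤ) → t + l - j ≡ t - (j - l) + m - m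
    upperU = solve-∀
    upperV : ∀ (l j m : ℤ) → j ≡ l + (j - l) - m + m
    upperV = solve-∀
    c = ∣ ((+ ∣ + 0 ∣) + m - + 0) + + 1 ⊔ + 0 ∣
    c≡m+1 : + c ≡ m + + 1
    c≡m+1 = cong +_ (trans (count-nonneg _) (cong (ℕ._+ 1) (ℕP.+-identityʳ k)))
    zeroPart : ∀ (x m n : ℤ) → x ≡ + 0 → x + m - n ≡ m - n
    zeroPart x m n refl = drop m n
      where
      drop : ∀ (m n : ℤ) → + 0 + m - n ≡ m - n
      drop = solve-∀
    βSum : β m s l j (+ 0) ≡ ∑ (+ 0) c (λ n → binomial (s - j) (m - n) * binomial j (m - n) * binomial (s - l + n) n)
    βSum = ∑-ext (+ 0) c (λ n → cong₂ (λ x y → binomial (s - j) x * binomial j y * binomial (s - l + n) n)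
                                      (zeroPart ((+ 0) ₊) m n (positivePart-pos 0)) (zeroPart ((+ 0) ₋) m n (negativePart-pos 0)))

  offDiagonalSummand≡terms : ∀ k kk → offDiagonalSummand s l j (+ k) (l - + 1 - + kk)
                                        ≡ T (+ k) (+ k + + 1 + + kk) + T (+ k + + 1 + + kk) (+ k)
  offDiagonalSummand≡terms k kk = begin
    offDiagonalSummand s l j m i                                    ≡⟨ distribute (pow-2 (i - + 2 * m)) M₁ β₁ M₂ β₂ ⟩
    pow-2 (i - + 2 * m) * M₁ * β₁ + pow-2 (i - + 2 * m) * M₂ * β₂   ≡⟨ cong₂ _+_ firstHalf secondHalf ⟩
    T m γ + T γ m                                                   ∎
    where
    open ≡-Reasoning
    m = + k
    i = l - + 1 - + kk
    γ = m + + 1 + + kk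
    M₁ = multinomial ((i - + 2 * m) ∷ (j - l + m) ∷ (s - i - j + m) ∷ [])
    M₂ = multinomial ((i - + 2 * m) ∷ (j - i + m) ∷ (s - l - j + m) ∷ [])
    β₁ = β m s l (i + j - l) (l - i)
    β₂ = β m s l (l + j - i) (i - l)
    distribute : ∀ p a b c e → p * (a * b + c * e) ≡ p * a * b + p * c * e
    distribute = solve-∀
    c = ∣ ((+ suc kk + m) - + 0) + + 1 ⊔ + 0 ∣
    c≡γ+1 : + c ≡ γ + + 1
    c≡γ+1 = cong +_ (trans (count-nonneg _) (size k kk))
      where
      size : ∀ k kk → suc kk ℕ.+ k ℕ.+ 0 ℕ.+ 1 ≡ k ℕ.+ 1 ℕ.+ kk ℕ.+ 1
      size = ℕSolver.solve-∀
    plusPart : ∀ (kk m n : ℤ) → + 1 + kk + m - n ≡ m + + 1 + kk - n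
    plusPart = solve-∀
    zeroPart : ∀ (m n : ℤ) → + 0 + m - n ≡ m - n
    zeroPart = solve-∀
    e₁' : ∀ (l k kk : ℤ) → l - + 1 - kk - + 2 * k ≡ l - k - (k + + 1 + kk)
    e₁' = solve-∀
    e₁ : i - + 2 * m ≡ l - m - γ
    e₁ = e₁' l m (+ kk)
    blocks₁ : ∀ (t l j m kk : ℤ) → (l - + 1 - kk - + 2 * m) + (j - l + m) + (t + l - (l - + 1 - kk) - j + m) ≡ t
    blocks₁ = solve-∀
    swap₁ : ∀ (l j m : ℤ) → j - l + m ≡ m + (j - l)
    swap₁ = solve-∀
    M₁≡ : M₁ ≡ trinomial t (l - m - γ) (m + d)
    M₁≡ = multinomial≡trinomial _ _ _ _ _ (blocks₁ t l j m (+ kk)) e₁ (swap₁ l j m)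
    l-i : ∀ (l kk : ℤ) → l - (l - + 1 - kk) ≡ + 1 + kk
    l-i = solve-∀
    β₁≡ : β₁ ≡ ∑ (+ 0) c (λ n → binomial (s - (i + j - l)) (γ - n) * binomial (i + j - l) (m - n) * binomial (s - l + n) n)
    β₁≡ = trans (cong (β m s l (i + j - l)) (l-i l (+ kk)))
                (∑-ext (+ 0) c (λ n → cong₂ (λ x y → binomial (s - (i + j - l)) x * binomial (i + j - l) y * binomial (s - l + n) n)
                   (trans (cong (λ z → z + m - n) (positivePart-pos (suc kk))) (plusPart (+ kk) m n))
                   (trans (cong (λ z → z + m - n) (negativePart-pos (suc kk))) (zeroPart m n))))
    upperU₁ : ∀ (t l j m kk : ℤ) → t + l - (l - + 1 - kk + j - l) ≡ t - (j - l) + (m + + 1 + kk) - m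
    upperU₁ = solve-∀
    upperV₁ : ∀ (l j m kk : ℤ) → l - + 1 - kk + j - l ≡ l + (j - l) - (m + + 1 + kk) + m
    upperV₁ = solve-∀
    e₂' : ∀ (l k kk : ℤ) → l - + 1 - kk - + 2 * k ≡ l - (k + + 1 + kk) - k
    e₂' = solve-∀
    e₂ : i - + 2 * m ≡ l - γ - m
    e₂ = e₂' l m (+ kk)
    blocks₂ : ∀ (t l j m kk : ℤ) → (l - + 1 - kk - + 2 * m) + (j - (l - + 1 - kk) + m) + (t + l - l - j + m) ≡ t
    blocks₂ = solve-∀
    swap₂ : ∀ (l j m kk : ℤ) → j - (l - + 1 - kk) + m ≡ m + + 1 + kk + (j - l)
    swap₂ = solve-∀
    M₂≡ : M₂ ≡ trinomial t (l - γ - m) (γ + d)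
    M₂≡ = multinomial≡trinomial _ _ _ _ _ (blocks₂ t l j m (+ kk)) e₂ (swap₂ l j m (+ kk))
    i-l : ∀ (l kk : ℤ) → l - + 1 - kk - l ≡ - (+ 1 + kk)
    i-l = solve-∀
    β₂≡ : β₂ ≡ ∑ (+ 0) c (λ n → binomial (s - (l + j - i)) (m - n) * binomial (l + j - i) (γ - n) * binomial (s - l + n) n)
    β₂≡ = trans (cong (β m s l (l + j - i)) (i-l l (+ kk)))
                (∑-ext (+ 0) c (λ n → cong₂ (λ x y → binomial (s - (l + j - i)) x * binomial (l + j - i) y * binomial (s - l + n) n)
                   (trans (cong (λ z → z + m - n) (positivePart-neg kk)) (zeroPart m n))
                   (trans (cong (λ z → z + m - n) (negativePart-neg kk)) (plusPart (+ kk) m n))))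
    upperU₂ : ∀ (t l j m kk : ℤ) → t + l - (l + j - (l - + 1 - kk)) ≡ t - (j - l) + m - (m + + 1 + kk)
    upperU₂ = solve-∀
    upperV₂ : ∀ (l j m kk : ℤ) → l + j - (l - + 1 - kk) ≡ l + (j - l) - m + (m + + 1 + kk)
    upperV₂ = solve-∀
    firstHalf : pow-2 (i - + 2 * m) * M₁ * β₁ ≡ T m γ
    firstHalf = trans (cong₃ (λ x y z → pow-2 x * y * z) e₁ M₁≡ β₁≡)
                      (β-term≡term m γ k (k ℕ.+ 1 ℕ.+ kk) c (s - (i + j - l)) (i + j - l) refl refl (inj₁ c≡γ+1)
                                   (upperU₁ t l j m (+ kk)) (upperV₁ l j m (+ kk)))
    secondHalf : pow-2 (i - + 2 * m) * M₂ * β₂ ≡ T γ m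
    secondHalf = trans (cong₃ (λ x y z → pow-2 x * y * z) e₂ M₂≡ β₂≡)
                       (β-term≡term γ m (k ℕ.+ 1 ℕ.+ kk) k c (s - (l + j - i)) (l + j - i) refl refl (inj₂ c≡γ+1)
                                    (upperU₂ t l j m (+ kk)) (upperV₂ l j m (+ kk)))

  hookArm : ℤ → ℤ → ℤ
  hookArm m k = T m (m + + 1 + k) + T (m + + 1 + k) m

  arm : ℤ → ℤ
  arm m = ∑ (+ 0) B (hookArm m)

  -- Terms with l - α - γ < 0 vanish; on the arm at m this means l < 2m + 1 + k.
  hookArm-vanishes : ∀ k kk r → + l' + + r ≡ + k + + k + + kk → hookArm (+ k) (+ kk) ≡ + 0
  hookArm-vanishes k kk r l+r≡ = cong₂ _+_
    (term-vanishes N t l d (+ k) (+ k + + 1 + + kk) r (trans (e₁ l (+ k) (+ kk)) (trans (cong (λ z → l - z - + 1) (sym l+r≡)) (e₂ l (+ r)))))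
    (term-vanishes N t l d (+ k + + 1 + + kk) (+ k) r (trans (e₃ l (+ k) (+ kk)) (trans (cong (λ z → l - z - + 1) (sym l+r≡)) (e₂ l (+ r)))))
    where
    e₁ : ∀ (l k kk : ℤ) → l - k - (k + + 1 + kk) ≡ l - (k + k + kk) - + 1
    e₁ = solve-∀
    e₃ : ∀ (l k kk : ℤ) → l - (k + + 1 + kk) - k ≡ l - (k + k + kk) - + 1
    e₃ = solve-∀
    e₂ : ∀ (l r : ℤ) → l - (l + r) - + 1 ≡ - (+ 1 + r)
    e₂ = solve-∀

  arm-vanishes : ∀ k → l' ℕ.≤ k ℕ.+ k → arm (+ k) ≡ + 0
  arm-vanishes k l'≤2k = ∑-vanish (+ 0) B (hookArm (+ k)) (λ kk _ → hookArm-vanishes k kk ((k ℕ.+ k ℕ.∸ l') ℕ.+ kk)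
    (cong +_ (trans (sym (ℕP.+-assoc l' (k ℕ.+ k ℕ.∸ l') kk)) (cong (ℕ._+ kk) (ℕP.m+[n∸m]≡n l'≤2k)))))

  -- The inner sum of the theorem at m is the arm of the hook at m: reversing the
  -- summation i = l-1-k pairs each summand with the two terms of the arm.
  innerSum : ℤ → ℤ
  innerSum m = Σ[ + 2 * m to l - + 1 ] (offDiagonalSummand s l j m)

  innerSum≡arm : ∀ k → innerSum (+ k) ≡ arm (+ k)
  innerSum≡arm k with ℕP.≤-<-connex l' (k ℕ.+ k)
  ... | inj₁ l'≤2k = trans (cong (λ z → sumFrom (+ 2 * m) z (offDiagonalSummand s l j m)) noTerms) (sym (arm-vanishes k l'≤2k))
    where
    m = + k
    r = k ℕ.+ k ℕ.∸ l'
    l+r≡2k : + l' + + r ≡ + k + + k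
    l+r≡2k = cong +_ (ℕP.m+[n∸m]≡n l'≤2k)
    length : ∀ (l k r : ℤ) → l + r ≡ k + k → (l - + 1 - + 2 * k) + + 1 ≡ - r
    length l k r l+r≡ = trans (twice l k) (trans (cong (_-_ l) (sym l+r≡)) (cancel l r))
      where
      twice : ∀ (l k : ℤ) → (l - + 1 - + 2 * k) + + 1 ≡ l - (k + k)
      twice = solve-∀
      cancel : ∀ (l r : ℤ) → l - (l + r) ≡ - r
      cancel = solve-∀
    noTerms : ∣ (l - + 1 - + 2 * m) + + 1 ⊔ + 0 ∣ ≡ 0
    noTerms = trans (cong (λ z → ∣ z ⊔ + 0 ∣) (length l m (+ r) l+r≡2k)) (count-nonpos r)
  ... | inj₂ 2k<l' = begin
    innerSum m                                            ≡⟨ cong (λ z → sumFrom (+ 2 * m) z (X m)) terms ⟩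
    ∑ (+ 2 * m) c (X m)                                   ≡⟨ ∑-reverse (+ 2 * m) c (X m) ⟩
    ∑ (+ 2 * m) c reversed                                ≡⟨ cong (λ z → ∑ z c reversed) (sym (ℤP.+-identityˡ (+ 2 * m))) ⟩
    ∑ (+ 0 + + 2 * m) c reversed                          ≡⟨ sym (∑-shift (+ 0) c (+ 2 * m) reversed) ⟩
    ∑ (+ 0) c (λ y → reversed (y + + 2 * m))              ≡⟨ ∑-cong (+ 0) c {λ y → reversed (y + + 2 * m)} {hookArm m}
                                                               (λ kk _ → trans (cong (X m) (index kk)) (offDiagonalSummand≡terms k kk)) ⟩
    ∑ (+ 0) c (hookArm m)
      ≡⟨ ∑-extend c B (hookArm m) c≤B (λ kk c≤kk → hookArm-vanishes k kk (kk ℕ.∸ c) (beyond kk c≤kk)) ⟩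
    arm m                                                 ∎
    where
    open ≡-Reasoning
    m = + k
    X = offDiagonalSummand s l j
    r = l' ℕ.∸ suc (k ℕ.+ k)
    c = suc r
    l≡1+2k+r : + l' ≡ + 1 + (+ k + + k) + + r
    l≡1+2k+r = cong +_ (sym (ℕP.m+[n∸m]≡n 2k<l'))
    length : ∀ (k r : ℤ) → (+ 1 + (k + k) + r - + 1 - + 2 * k) + + 1 ≡ + 1 + r
    length = solve-∀
    terms : ∣ (l - + 1 - + 2 * m) + + 1 ⊔ + 0 ∣ ≡ c
    terms = trans (cong (λ z → ∣ (z - + 1 - + 2 * m) + + 1 ⊔ + 0 ∣) l≡1+2k+r)
                  (trans (cong (λ z → ∣ z ⊔ + 0 ∣) (length m (+ r))) (count-nonneg c))
    reversed : ℤ → ℤ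
    reversed x = X m (+ 2 * m + + 2 * m + + c - + 1 - x)
    reflect : ∀ (k r kk : ℤ) → + 2 * k + + 2 * k + (+ 1 + r) - + 1 - (kk + + 2 * k) ≡ + 1 + (k + k) + r - + 1 - kk
    reflect = solve-∀
    index : ∀ kk → + 2 * m + + 2 * m + + c - + 1 - (+ 0 + + kk + + 2 * m) ≡ l - + 1 - + kk
    index kk = trans (reflect m (+ r) (+ kk)) (cong (λ z → z - + 1 - + kk) (sym l≡1+2k+r))
    c≤B : c ℕ.≤ B
    c≤B = ℕ.s≤s (ℕP.≤-trans (ℕP.m∸n≤m l' (suc (k ℕ.+ k))) (ℕP.n≤1+n l'))
    beyond : ∀ kk → c ℕ.≤ kk → + l' + + (kk ℕ.∸ c) ≡ + k + + k + + kk
    beyond kk c≤kk = trans (cong (λ z → z + + (kk ℕ.∸ c)) l≡1+2k+r)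
                           (trans (regroup (+ k) (+ r) (+ (kk ℕ.∸ c))) (cong (λ z → + k + + k + + z) (ℕP.m+[n∸m]≡n c≤kk)))
      where
      regroup : ∀ (k r x : ℤ) → + 1 + (k + k) + r + x ≡ k + k + (+ 1 + r + x)
      regroup = solve-∀

  offDiagonalPart : Σ[ + 0 to ⌊ l - + 1 /2⌋ ] innerSum ≡ ∑ (+ 0) B arm
  offDiagonalPart = trans (∑-cong (+ 0) count {innerSum} {arm} (λ i _ → innerSum≡arm i))
                          (∑-extend₂ count B arm (λ i beyond → arm-vanishes i (beyond-⌊l-1/2⌋ l' i beyond))
                                                 (λ i B≤i → arm-vanishes i (ℕP.≤-trans l'≤B (ℕP.≤-trans B≤i (ℕP.m≤m+n i i)))))
    where
    count = ∣ (⌊ l - + 1 /2⌋ - + 0) + + 1 ⊔ + 0 ∣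
    l'≤B : l' ℕ.≤ B
    l'≤B = ℕP.≤-trans (ℕP.n≤1+n l') (ℕP.n≤1+n (suc l'))

  diagonalTerm-vanishes : ∀ i → suc l' ℕ.≤ i ℕ.+ i → T (+ i) (+ i) ≡ + 0
  diagonalTerm-vanishes i l<2i =
    term-vanishes N t l d (+ i) (+ i) r (trans (twice l (+ i)) (trans (cong (λ z → l - z) (cong +_ (sym l+1+r≡2i))) (cancel l (+ r))))
    where
    r = i ℕ.+ i ℕ.∸ suc l'
    l+1+r≡2i : suc l' ℕ.+ r ≡ i ℕ.+ i
    l+1+r≡2i = ℕP.m+[n∸m]≡n l<2i
    twice : ∀ (l i : ℤ) → l - i - i ≡ l - (i + i)
    twice = solve-∀
    cancel : ∀ (l r : ℤ) → l - (+ 1 + l + r) ≡ - (+ 1 + r)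
    cancel = solve-∀

  diagonalPart : Σ[ + 0 to ⌊ l /2⌋ ] (diagonalSummand s l j) ≡ ∑ (+ 0) B (λ m → T m m)
  diagonalPart = trans (∑-cong (+ 0) count {diagonalSummand s l j} {λ m → T m m} (λ i _ → diagonalSummand≡term i))
                       (∑-extend₂ count B (λ m → T m m) (λ i beyond → diagonalTerm-vanishes i (beyond-⌊l/2⌋ l' i beyond))
                          (λ i B≤i → diagonalTerm-vanishes i (ℕP.≤-trans (ℕP.≤-trans (ℕP.n≤1+n (suc l')) B≤i) (ℕP.m≤m+n i i))))
    where
    count = ∣ (⌊ l /2⌋ - + 0) + + 1 ⊔ + 0 ∣

  T-outside : ∀ i k → B ℕ.≤ i ⊎ B ℕ.≤ k → T (+ i) (+ k) ≡ + 0
  T-outside i k (inj₁ B≤i) = term-vanishes N t l d (+ i) (+ k) (suc (i ℕ.∸ B ℕ.+ k))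
    (trans (cong (λ z → l - + z - + k) (sym (ℕP.m+[n∸m]≡n B≤i))) (normalise l (+ (i ℕ.∸ B)) (+ k)))
    where
    normalise : ∀ (l x k : ℤ) → l - (+ 1 + (+ 1 + l) + x) - k ≡ - (+ 1 + (+ 1 + (x + k)))
    normalise = solve-∀
  T-outside i k (inj₂ B≤k) = term-vanishes N t l d (+ i) (+ k) (suc (k ℕ.∸ B ℕ.+ i))
    (trans (cong (λ z → l - + i - + z) (sym (ℕP.m+[n∸m]≡n B≤k))) (normalise l (+ (k ℕ.∸ B)) (+ i)))
    where
    normalise : ∀ (l x i : ℤ) → l - i - (+ 1 + (+ 1 + l) + x) ≡ - (+ 1 + (+ 1 + (x + i)))
    normalise = solve-∀

  mainSum-byHooks : mainSum l' t d ≡ ∑ (+ 0) B (λ m → T m m) + ∑ (+ 0) B arm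
  mainSum-byHooks = trans (∑∑≡hookSum B B T ℕP.≤-refl T-outside) (∑-+ (+ 0) B (λ m → T m m) arm)

  paperSum≡binomial : paperSum s l j ≡ binomial s j
  paperSum≡binomial = begin
    paperSum s l j                                           ≡⟨ cong₂ _+_ offDiagonalPart diagonalPart ⟩
    ∑ (+ 0) B arm + ∑ (+ 0) B (λ m → T m m)                  ≡⟨ ℤP.+-comm (∑ (+ 0) B arm) _ ⟩
    ∑ (+ 0) B (λ m → T m m) + ∑ (+ 0) B arm                  ≡⟨ sym mainSum-byHooks ⟩
    mainSum l' t d                                           ≡⟨ mainSum-closedForm l' t' d ⟩
    choose (t + l) (l + d)                                   ≡⟨ cong (choose s) (l+[j-l]≡j l j) ⟩
    choose s j                                               ≡⟨ sym (binomial≡choose s j (ℤ.+≤+ ℕ.z≤n)) ⟩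
    binomial s j                                             ∎
    where
    open ≡-Reasoning
    l+[j-l]≡j : ∀ (l j : ℤ) → l + (j - l) ≡ j
    l+[j-l]≡j = solve-∀

-- For 0 ≤ l ≤ s write s = (s - l) + l.
theorem1p1 : (s l j : ℤ) → + 0 ≤ l → l ≤ s →
    Σ[ + 0 to ⌊ l - + 1 /2⌋ ] (λ m →
      Σ[ + 2 * m to l - + 1 ] (λ i →
        pow-2 (i - + 2 * m)
        * ( multinomial ((i - + 2 * m) ∷ (j - l + m) ∷ (s - i - j + m) ∷ [])
              * β m s l (i + j - l) (l - i)
          + multinomial ((i - + 2 * m) ∷ (j - i + m) ∷ (s - l - j + m) ∷ [])
              * β m s l (l + j - i) (i - l))))
    + Σ[ + 0 to ⌊ l /2⌋ ] (λ m →
        pow-2 (l - + 2 * m)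
        * multinomial ((l - + 2 * m) ∷ (j - l + m) ∷ (s - l - j + m) ∷ [])
        * β m s l j (+ 0))
    ≡ binomial s j
theorem1p1 (+ s') (+ l') j _ (ℤ.+≤+ l'≤s') =
  subst (λ s → paperSum s (+ l') j ≡ binomial s j) (cong +_ (ℕP.m∸n+n≡m l'≤s'))
        (Translation.paperSum≡binomial (s' ℕ.∸ l') l' j)
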